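{- Let $n, t$ be positive integers such that for any two distinct prime powers $p^k, q^l$ with $k,l\ge1$, $p^k \,\|\, n$ and $q^l \,\|\, n$, one has $\gcd\!\left(\frac{p^{t(k+1)}-1}{p^t-1}, \frac{q^{t(l+1)}-1}{q^t-1}\right) = 1$. Let $$S := \left\langle \left\{ \sigma_t(m) : m \text{ is a positive integer and } \tfrac{m}{n} \text{ is a prime power} \right\}\right\rangle,$$ where $1$ counts as a prime power. Then $S$ is a numerical semigroup with Frobenius number $$F(S) = \sigma_t(n)\left(-1 + \sum_{1 < p^k \,\|\, n} \frac{p^{2t(k+1)} - p^t}{p^{t(k+1)} - 1}\right),$$ where the sum ranges over prime powers $p^k>1$ with $p^k\,\|\,n$.
   Context: $\sigma_t(m) := \sum_{d \mid m} d^t$. For a prime power $p^k$, $p^k \,\|\, n$ means $p^k \mid n$ but $p^{k+1}\nmid n$. For a set $A$ of positive integers, $\langle A\rangle$ is the submonoid of $(\mathbb{N},+)$ generated by $A$ ($\mathbb{N}$ = nonnegative integers). A numerical semigroup is a submonoid $S\subseteq\mathbb{N}$ with $\mathbb{N}\setminus S$ finite; its Frobenius number $F(S)$ is the largest integer not in $S$ (with $F(\mathbb{N})=-1$). -}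

module Defs where

open import Data.Nat using (ℕ; zero; suc; _+_; _*_; _∸_; _^_; _≤_; _<_)
open import Data.Nat.Divisibility using (_∣_; _∣?_)
open import Data.Nat.Primality using (Prime; prime?)
open import Data.Nat.DivMod using (_/_)
open import Data.Integer using (ℤ; +_)
import Data.Integer as ℤ
import Data.Rational as ℚ
open import Data.Rational using (ℚ; 0ℚ; 1ℚ)
open import Data.List using (List; []; _∷_; map; filter; applyUpTo; concatMap; foldr)
open import Data.Nat.ListAction using (sum)
open import Data.Product using (Σ; _×_; _,_; proj₁; proj₂)
open import Data.Sum using (_⊎_)
open import Relation.Nullary using (¬_; Dec; _×-dec_; ¬?)
open import Relation.Binary.PropositionalEquality using (_≡_)

range1 : ℕ → List ℕ
range1 m = applyUpTo suc m

σ : ℕ → ℕ → ℕ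
σ t m = sum (map (λ d → d ^ t) (filter (λ d → d ∣? m) (range1 m)))

_^_∥_ : ℕ → ℕ → ℕ → Set
p ^ k ∥ n = (p ^ k ∣ n) × ¬ (p ^ suc k ∣ n)

IsPrimePower : ℕ → Set
IsPrimePower q = (q ≡ 1) ⊎ Σ ℕ (λ p → Σ ℕ (λ e → Prime p × 1 ≤ e × q ≡ p ^ e))

-- truncated (total) natural-number division; used only with nonzero divisors
divℕ : ℕ → ℕ → ℕ
divℕ a zero    = 0
divℕ a (suc d) = a / suc d

-- a / d as a rational number (total; used only with nonzero d)
divℚ : ℕ → ℕ → ℚ
divℚ a zero    = 0ℚ
divℚ a (suc d) = (+ a) ℚ./ suc d

IsGenerator : ℕ → ℕ → ℕ → Set
IsGenerator n t a =
  Σ ℕ (λ m → Σ ℕ (λ q → 1 ≤ m × IsPrimePower q × m ≡ n * q × a ≡ σ t m))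

data ⟨_⟩ (A : ℕ → Set) : ℕ → Set where
  zero∈ : ⟨ A ⟩ 0
  gen+  : ∀ {a x} → A a → ⟨ A ⟩ x → ⟨ A ⟩ (a + x)

S : ℕ → ℕ → ℕ → Set
S n t = ⟨ IsGenerator n t ⟩

-- a submonoid of ℕ is a numerical semigroup iff its complement is finite
IsNumericalSemigroup : (ℕ → Set) → Set
IsNumericalSemigroup M = Σ ℕ (λ N → ∀ x → N ≤ x → M x)

_∈ℤ_ : ℤ → (ℕ → Set) → Set
z ∈ℤ M = Σ ℕ (λ x → z ≡ + x × M x)

IsFrobeniusNumber : (ℕ → Set) → ℤ → Set
IsFrobeniusNumber M f = ¬ (f ∈ℤ M) × (∀ (z : ℤ) → f ℤ.< z → z ∈ℤ M)

-- the pairs (p , k) with p prime, k ≥ 1 and p^k ∥ n, i.e. the prime powers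
-- 1 < p^k ∥ n (for n ≥ 1 necessarily p ≤ n and k ≤ n, so the search is exhaustive)
exactPrimePowers : ℕ → List (ℕ × ℕ)
exactPrimePowers n =
  concatMap (λ p → map (λ k → (p , k))
                       (filter (λ k → (p ^ k ∣? n) ×-dec ¬? (p ^ suc k ∣? n)) (range1 n)))
            (filter prime? (range1 n))

ℤtoℚ : ℤ → ℚ
ℤtoℚ z = z ℚ./ 1

term : ℕ → ℕ → ℕ → ℚ
term t p k = divℚ (p ^ (2 * t * (k + 1)) ∸ p ^ t) (p ^ (t * (k + 1)) ∸ 1)

frobeniusFormula : ℕ → ℕ → ℚ
frobeniusFormula n t =
  (+ σ t n ℚ./ 1) ℚ.* (ℚ.- 1ℚ ℚ.+ foldr (λ pk acc → term t (proj₁ pk) (proj₂ pk) ℚ.+ acc) 0ℚ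
                                        (exactPrimePowers n))

geomQuot : ℕ → ℕ → ℕ → ℕ
geomQuot t p k = divℕ (p ^ (t * (k + 1)) ∸ 1) (p ^ t ∸ 1)

CoprimeHyp : ℕ → ℕ → Set
CoprimeHyp n t =
  ∀ p k q l → Prime p → Prime q → 1 ≤ k → 1 ≤ l →
  p ^ k ∥ n → q ^ l ∥ n → ¬ (p ^ k ≡ q ^ l) →
  Data.Nat.GCD.gcd (geomQuot t p k) (geomQuot t q l) ≡ 1
  where import Data.Nat.GCD

-- For each exact prime power p^k ∥ n let s_j = 1 + p^t + ⋯ + p^(tj). By multiplicativity of σ_t,
-- the generators σ_t(n q) are σ_t(n / p^k) · s_(k+e) when q = p^e, and multiples of s_k when
-- p ∤ q. Hence S is the iterated gluing, along the pairwise coprime s_k, of the semigroups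
-- T_p = ⟨ s_j : j ≥ k ⟩. The Apéry set of T_p with respect to s_k has an explicit maximum W_p,
-- with W_p / s_k = (p^(2t(k+1)) - p^t) / (p^(t(k+1)) - 1). Apéry maxima combine linearly under
-- gluing, so the Apéry set of S with respect to σ_t(n) = ∏ s_k has maximum σ_t(n) · Σ W_p / s_k,
-- and the Frobenius number is this maximum minus σ_t(n).

module Submission where

open import Defs
open import Data.Nat
open import Data.Nat.Properties
open import Data.Nat.DivMod using (_/_; _%_; m≡m%n+[m/n]*n; [m+kn]%n≡m%n; m<n⇒m%n≡m; m%n<n; m%n%n≡m%n; m*n/n≡m)
open import Data.Nat.Divisibility
open import Data.Nat.Primality
open import Data.Nat.Primality.Factorisation using (factorise)
open import Data.Nat.Coprimality as Coprime using (Coprime; coprime-Bézout; coprime-divisor; gcd≡1⇒coprime)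
open import Data.Nat.GCD using (module Bézout; gcd)
open import Data.Nat.ListAction using (sum; product)
open import Data.Nat.ListAction.Properties using (sum-++; sum-↭)
open import Data.Nat.Tactic.RingSolver using (solve-∀)
open import Data.Integer as ℤ using (ℤ; -[1+_]; _⊖_; -≤-)
import Data.Integer.Properties as ℤP
import Data.Integer.Tactic.RingSolver as ℤ-Solver
open import Data.Rational as ℚ using (ℚ; 0ℚ; 1ℚ; toℚᵘ)
import Data.Rational.Properties as ℚP
open import Data.Rational.Unnormalised as ℚᵘ using (mkℚᵘ; *≡*)
import Data.Rational.Unnormalised.Properties as ℚᵘP
open import Data.Rational.Solver using (module +-*-Solver)
open import Data.List using (List; []; _∷_; map; filter; concatMap; _++_; replicate; length; foldr)
open import Data.List.Properties using (map-++; length-++; length-replicate)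
open import Data.List.Membership.Propositional using (_∈_)
open import Data.List.Membership.Propositional.Properties
open import Data.List.Membership.Propositional.Properties.WithK using (unique∧set⇒bag)
open import Data.List.Relation.Unary.Any using (here; there)
open import Data.List.Relation.Unary.All as All using (All; []; _∷_)
open import Data.List.Relation.Unary.Unique.Propositional using (Unique)
open import Data.List.Relation.Unary.AllPairs using ([]; _∷_)
import Data.List.Relation.Unary.Unique.Propositional.Properties as Unique
open import Data.List.Relation.Binary.BagAndSetEquality using (∼bag⇒↭)
import Data.List.Relation.Binary.Permutation.Propositional.Properties as Perm
open import Data.Product using (Σ; _×_; _,_; proj₁; proj₂)
open import Data.Sum using (_⊎_; inj₁; inj₂)
open import Data.Unit using (⊤; tt)
open import Data.Empty using (⊥-elim)
open import Function.Bundles using (mk⇔)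
open import Relation.Nullary using (¬_; Dec; yes; no)
open import Relation.Nullary.Decidable using (_×-dec_; ¬?)
open import Relation.Unary using (_⊆_)
open import Relation.Binary.Definitions using (tri<; tri≈; tri>)
open import Relation.Binary.PropositionalEquality
open import Function.Base using (_∘_)

-- Repunits

repunit : ℕ → ℕ → ℕ
repunit P zero    = 1
repunit P (suc j) = 1 + P * repunit P j

repunit>0 : ∀ P j → repunit P j > 0
repunit>0 P zero    = z<s
repunit>0 P (suc j) = z<s

repunit-+ : ∀ P a b → repunit P (a + suc b) ≡ repunit P a + P ^ suc a * repunit P b
repunit-+ P zero    b = cong (λ x → 1 + x * repunit P b) (sym (*-identityʳ P))
repunit-+ P (suc a) b rewrite repunit-+ P a b = expand P (repunit P a) (P ^ suc a) (repunit P b)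
  where expand : ∀ P x y z → 1 + P * (x + y * z) ≡ 1 + P * x + P * y * z
        expand = solve-∀

repunit-geometric : ∀ Q j → Q * repunit (suc Q) j + 1 ≡ suc Q ^ suc j
repunit-geometric Q zero    = +-comm (Q * 1) 1
repunit-geometric Q (suc j) =
  trans (expand Q (repunit (suc Q) j)) (cong (suc Q *_) (repunit-geometric Q j))
  where expand : ∀ Q r → Q * (1 + (1 + Q) * r) + 1 ≡ (1 + Q) * (Q * r + 1)
        expand = solve-∀

repunit-mono-≤ : ∀ P {a b} → a ≤ b → repunit P a ≤ repunit P b
repunit-mono-≤ P {b = b} z≤n   = repunit>0 P b
repunit-mono-≤ P (s≤s a≤b) = +-monoʳ-≤ 1 (*-monoʳ-≤ P (repunit-mono-≤ P a≤b))

-- Congruences of natural numbers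

infix 4 _≡[_]_
_≡[_]_ : ℕ → ℕ → ℕ → Set
a ≡[ m ] b = Σ ℕ λ u → Σ ℕ λ v → a + u * m ≡ b + v * m

%≡⇒≡[] : ∀ a b m .{{_ : NonZero m}} → a % m ≡ b % m → a ≡[ m ] b
%≡⇒≡[] a b m eq = b / m , a / m , (begin
    a + b / m * m                 ≡⟨ cong (_+ b / m * m) (m≡m%n+[m/n]*n a m) ⟩
    a % m + a / m * m + b / m * m ≡⟨ cong (λ z → z + a / m * m + b / m * m) eq ⟩
    b % m + a / m * m + b / m * m ≡⟨ swap (b % m) (a / m * m) (b / m * m) ⟩
    b % m + b / m * m + a / m * m ≡⟨ cong (_+ a / m * m) (sym (m≡m%n+[m/n]*n b m)) ⟩
    b + a / m * m                 ∎)
  where open ≡-Reasoning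
        swap : ∀ x y z → x + y + z ≡ x + z + y
        swap = solve-∀

≡[]⇒%≡ : ∀ a b m .{{_ : NonZero m}} → a ≡[ m ] b → a % m ≡ b % m
≡[]⇒%≡ a b m (u , v , eq) = begin
  a % m           ≡⟨ sym ([m+kn]%n≡m%n a u m) ⟩
  (a + u * m) % m ≡⟨ cong (_% m) eq ⟩
  (b + v * m) % m ≡⟨ [m+kn]%n≡m%n b v m ⟩
  b % m           ∎
  where open ≡-Reasoning

module _ {m : ℕ} where

  ≡[]-sym : ∀ {a b} → a ≡[ m ] b → b ≡[ m ] a
  ≡[]-sym (u , v , eq) = v , u , sym eq

  ≡[]-trans : ∀ {a b c} → a ≡[ m ] b → b ≡[ m ] c → a ≡[ m ] c
  ≡[]-trans {a} {b} {c} (u₁ , v₁ , e₁) (u₂ , v₂ , e₂) = u₁ + u₂ , v₂ + v₁ , (begin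
    a + (u₁ + u₂) * m       ≡⟨ split a u₁ u₂ m ⟩
    (a + u₁ * m) + u₂ * m   ≡⟨ cong (_+ u₂ * m) e₁ ⟩
    (b + v₁ * m) + u₂ * m   ≡⟨ swap b v₁ u₂ m ⟩
    (b + u₂ * m) + v₁ * m   ≡⟨ cong (_+ v₁ * m) e₂ ⟩
    (c + v₂ * m) + v₁ * m   ≡⟨ sym (split c v₂ v₁ m) ⟩
    c + (v₂ + v₁) * m       ∎)
    where open ≡-Reasoning
          split : ∀ a u₁ u₂ m → a + (u₁ + u₂) * m ≡ (a + u₁ * m) + u₂ * m
          split = solve-∀
          swap : ∀ b v₁ u₂ m → (b + v₁ * m) + u₂ * m ≡ (b + u₂ * m) + v₁ * m
          swap = solve-∀

  ≡[]-+ : ∀ {a b c d} → a ≡[ m ] b → c ≡[ m ] d → a + c ≡[ m ] b + d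
  ≡[]-+ {a} {b} {c} {d} (u₁ , v₁ , e₁) (u₂ , v₂ , e₂) =
    u₁ + u₂ , v₁ + v₂ , trans (regroup a c u₁ u₂ m) (trans (cong₂ _+_ e₁ e₂) (sym (regroup b d v₁ v₂ m)))
    where regroup : ∀ a c u₁ u₂ m → a + c + (u₁ + u₂) * m ≡ (a + u₁ * m) + (c + u₂ * m)
          regroup = solve-∀

≡[]-*ˡ : ∀ {a b m} c → a ≡[ m ] b → c * a ≡[ c * m ] c * b
≡[]-*ˡ {a} {b} {m} c (u , v , e) = u , v , trans (factor c a u m) (trans (cong (c *_) e) (sym (factor c b v m)))
  where factor : ∀ c a u m → c * a + u * (c * m) ≡ c * (a + u * m)
        factor = solve-∀

private
  ≡[]-cancel-coprime-≥ : ∀ {m c a b} → Coprime m c → b ≤ a → c * a ≡[ m ] c * b → a ≡[ m ] b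
  ≡[]-cancel-coprime-≥ {m} {c} {a} {b} cop b≤a (u , v , e) with coprime-divisor cop m∣cd
    where
      open ≡-Reasoning
      d = a ∸ b
      e′ : c * d + u * m ≡ v * m
      e′ = +-cancelˡ-≡ (c * b) _ _ (begin
        c * b + (c * d + u * m) ≡⟨ regroup c b d (u * m) ⟩
        c * (b + d) + u * m     ≡⟨ cong (λ z → c * z + u * m) (m+[n∸m]≡n b≤a) ⟩
        c * a + u * m           ≡⟨ e ⟩
        c * b + v * m           ∎)
        where regroup : ∀ c b d x → c * b + (c * d + x) ≡ c * (b + d) + x
              regroup = solve-∀
      m∣cd : m ∣ c * d
      m∣cd = divides (v ∸ u) (begin
        c * d                 ≡⟨ sym (m+n∸n≡m (c * d) (u * m)) ⟩
        c * d + u * m ∸ u * m ≡⟨ cong (_∸ u * m) e′ ⟩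
        v * m ∸ u * m         ≡⟨ sym (*-distribʳ-∸ m v u) ⟩
        (v ∸ u) * m           ∎)
  ... | divides q d≡qm = 0 , q , trans (+-identityʳ a) (trans (sym (m+[n∸m]≡n b≤a)) (cong (b +_) d≡qm))

≡[]-cancel-coprime : ∀ {m c a b} → Coprime m c → c * a ≡[ m ] c * b → a ≡[ m ] b
≡[]-cancel-coprime {a = a} {b} cop ca≡cb with ≤-total b a
... | inj₁ b≤a = ≡[]-cancel-coprime-≥ cop b≤a ca≡cb
... | inj₂ a≤b = ≡[]-sym (≡[]-cancel-coprime-≥ cop a≤b (≡[]-sym ca≡cb))

≡[]⇒≡+multiple⊎>+multiple : ∀ {a x N} → a ≡[ N ] x →
  (Σ ℕ λ c → x ≡ a + c * N) ⊎ (Σ ℕ λ c → a ≡ x + suc c * N)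
≡[]⇒≡+multiple⊎>+multiple {a} {x} {N} (u , v , e) with ≤-total v u
... | inj₁ v≤u = inj₁ (u ∸ v , +-cancelʳ-≡ (v * N) x (a + (u ∸ v) * N) (begin
      x + v * N               ≡⟨ sym e ⟩
      a + u * N               ≡⟨ cong (λ z → a + z * N) (sym (m∸n+n≡m v≤u)) ⟩
      a + (u ∸ v + v) * N     ≡⟨ split a (u ∸ v) v N ⟩
      a + (u ∸ v) * N + v * N ∎))
  where open ≡-Reasoning
        split : ∀ a w v N → a + (w + v) * N ≡ a + w * N + v * N
        split = solve-∀
... | inj₂ u≤v with m≤n⇒m<n∨m≡n u≤v
...   | inj₂ refl = inj₁ (0 , sym (trans (+-identityʳ a) (+-cancelʳ-≡ (u * N) a x e)))
...   | inj₁ u<v  = inj₂ (v ∸ suc u , +-cancelʳ-≡ (u * N) a (x + suc (v ∸ suc u) * N) (begin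
      a + u * N                         ≡⟨ e ⟩
      x + v * N                         ≡⟨ cong (λ z → x + z * N) (sym (m∸n+n≡m u<v)) ⟩
      x + (v ∸ suc u + suc u) * N       ≡⟨ split x (v ∸ suc u) u N ⟩
      x + suc (v ∸ suc u) * N + u * N   ∎))
  where open ≡-Reasoning
        split : ∀ x w u N → x + (w + (1 + u)) * N ≡ x + (1 + w) * N + u * N
        split = solve-∀

coprime⇒sum-hits-residues : ∀ {s s′} → Coprime s s′ → 1 ≤ s → 1 ≤ s′ → ∀ ρ →
                            Σ ℕ λ u → Σ ℕ λ v → s′ * u + s * v ≡[ s * s′ ] ρ
coprime⇒sum-hits-residues {suc s₀} {s′} cop _ _ ρ with coprime-Bézout cop
... | Bézout.+- x y eq = ρ * y * s₀ , ρ * x , 0 , ρ * y , (begin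
      s′ * (ρ * y * s₀) + suc s₀ * (ρ * x) + 0 ≡⟨ regroup s′ ρ y s₀ x ⟩
      s′ * (ρ * y * s₀) + ρ * (x * suc s₀)     ≡⟨ cong (λ z → s′ * (ρ * y * s₀) + ρ * z) (sym eq) ⟩
      s′ * (ρ * y * s₀) + ρ * (1 + y * s′)     ≡⟨ collect s′ ρ y s₀ ⟩
      ρ + ρ * y * (suc s₀ * s′)               ∎)
  where open ≡-Reasoning
        regroup : ∀ s′ ρ y s₀ x → s′ * (ρ * y * s₀) + (1 + s₀) * (ρ * x) + 0 ≡ s′ * (ρ * y * s₀) + ρ * (x * (1 + s₀))
        regroup = solve-∀
        collect : ∀ s′ ρ y s₀ → s′ * (ρ * y * s₀) + ρ * (1 + y * s′) ≡ ρ + ρ * y * ((1 + s₀) * s′)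
        collect = solve-∀
coprime⇒sum-hits-residues {suc s₀} {suc s₀′} cop _ _ ρ | Bézout.-+ x y eq = ρ * y , ρ * x * s₀′ , 0 , ρ * x , (begin
      suc s₀′ * (ρ * y) + suc s₀ * (ρ * x * s₀′) + 0 ≡⟨ regroup s₀′ ρ y s₀ x ⟩
      ρ * (y * suc s₀′) + suc s₀ * (ρ * x * s₀′)     ≡⟨ cong (λ z → ρ * z + suc s₀ * (ρ * x * s₀′)) (sym eq) ⟩
      ρ * (1 + x * suc s₀) + suc s₀ * (ρ * x * s₀′)  ≡⟨ collect s₀′ ρ s₀ x ⟩
      ρ + ρ * x * (suc s₀ * suc s₀′)                 ∎)
  where open ≡-Reasoning
        regroup : ∀ s₀′ ρ y s₀ x → (1 + s₀′) * (ρ * y) + (1 + s₀) * (ρ * x * s₀′) + 0 ≡ ρ * (y * (1 + s₀′)) + (1 + s₀) * (ρ * x * s₀′)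
        regroup = solve-∀
        collect : ∀ s₀′ ρ s₀ x → ρ * (1 + x * (1 + s₀)) + (1 + s₀) * (ρ * x * s₀′) ≡ ρ + ρ * x * ((1 + s₀) * (1 + s₀′))
        collect = solve-∀

-- Submonoids with a known Apéry maximum

⟨⟩-+ : ∀ {G : ℕ → Set} {x y} → ⟨ G ⟩ x → ⟨ G ⟩ y → ⟨ G ⟩ (x + y)
⟨⟩-+ zero∈ y∈ = y∈
⟨⟩-+ {G} {y = y} (gen+ {a} {x} a∈ x∈) y∈ = subst ⟨ G ⟩ (sym (+-assoc a x y)) (gen+ a∈ (⟨⟩-+ x∈ y∈))

⟨⟩-multiple : ∀ {G : ℕ → Set} {g} → G g → ∀ c → ⟨ G ⟩ (c * g)
⟨⟩-multiple g∈ zero    = zero∈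
⟨⟩-multiple g∈ (suc c) = gen+ g∈ (⟨⟩-multiple g∈ c)

⟨⟩-scale : ∀ {G H : ℕ → Set} c → (∀ {g} → G g → H (c * g)) → ∀ {x} → ⟨ G ⟩ x → ⟨ H ⟩ (c * x)
⟨⟩-scale {H = H} c scale zero∈ = subst ⟨ H ⟩ (sym (*-zeroʳ c)) zero∈
⟨⟩-scale {H = H} c scale (gen+ {g} {x} g∈ x∈) =
  subst ⟨ H ⟩ (sym (*-distribˡ-+ c g x)) (gen+ (scale g∈) (⟨⟩-scale c scale x∈))

-- W is the largest element of the Apéry set of A with respect to s, so F(A) = W - s.
record AperyMax (A : ℕ → Set) (s W : ℕ) : Set where
  field
    0∈    : A 0
    +∈    : ∀ {x y} → A x → A y → A (x + y)
    s∈    : A s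
    1≤s   : 1 ≤ s
    s≤1+W : s ≤ suc W
    cover : ∀ ρ → Σ ℕ λ a → A a × a ≤ W × a ≡[ s ] ρ
    lower : ∀ a → A a → a ≡[ s ] W → W ≤ a

n⊖1+n≡-1 : ∀ n → n ⊖ suc n ≡ -[1+ 0 ]
n⊖1+n≡-1 zero    = refl
n⊖1+n≡-1 (suc n) = trans (ℤP.[1+m]⊖[1+n]≡m⊖n n (suc n)) (n⊖1+n≡-1 n)

module _ {A : ℕ → Set} {s W : ℕ} (apery : AperyMax A s W) where
  open AperyMax apery

  multiple∈ : ∀ c → A (c * s)
  multiple∈ zero    = 0∈
  multiple∈ (suc c) = +∈ s∈ (multiple∈ c)

  AperyMax⇒∈ : ∀ x → W < x + s → A x
  AperyMax⇒∈ x W<x+s with cover x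
  ... | a , a∈ , a≤W , a≡x with ≡[]⇒≡+multiple⊎>+multiple a≡x
  ...   | inj₁ (c , x≡) = subst A (sym x≡) (+∈ a∈ (multiple∈ c))
  ...   | inj₂ (c , a≡) = ⊥-elim (<⇒≱ W<x+s (begin
          x + s             ≤⟨ +-monoʳ-≤ x (m≤m+n s (c * s)) ⟩
          x + suc c * s     ≡⟨ sym a≡ ⟩
          a                 ≤⟨ a≤W ⟩
          W                 ∎))
    where open ≤-Reasoning

  AperyMax⇒numerical : IsNumericalSemigroup A
  AperyMax⇒numerical = W , λ x W≤x → AperyMax⇒∈ x (≤-trans (s≤s W≤x) (≤-trans (≤-reflexive (+-comm 1 x)) (+-monoʳ-≤ x 1≤s)))

  private
    frob+s≡W : W ⊖ s ℤ.+ ℤ.+ s ≡ ℤ.+ W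
    frob+s≡W = trans (cong (ℤ._+ ℤ.+ s) (sym (ℤP.m-n≡m⊖n W s))) (cancel (ℤ.+ W) (ℤ.+ s))
      where cancel : ∀ a b → a ℤ.+ ℤ.- b ℤ.+ b ≡ a
            cancel = ℤ-Solver.solve-∀

    -1≤frob : -[1+ 0 ] ℤ.≤ W ⊖ s
    -1≤frob = ℤP.≤-trans (ℤP.≤-reflexive (sym (n⊖1+n≡-1 W))) (ℤP.⊖-monoʳ-≥-≤ W s≤1+W)

  AperyMax⇒frobenius : IsFrobeniusNumber A (W ⊖ s)
  AperyMax⇒frobenius = frob∉ , above-frob∈
    where
      frob∉ : ¬ (W ⊖ s) ∈ℤ A
      frob∉ (x , frob≡x , x∈) = <⇒≱ x<W (lower x x∈ (1 , 0 , x+s≡W+0))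
        where
          x+s≡W : x + s ≡ W
          x+s≡W = ℤP.+-injective (trans (ℤP.pos-+ x s) (trans (cong (ℤ._+ ℤ.+ s) (sym frob≡x)) frob+s≡W))
          x<W : x < W
          x<W = ≤-trans (≤-reflexive (+-comm 1 x)) (≤-trans (+-monoʳ-≤ x 1≤s) (≤-reflexive x+s≡W))
          x+s≡W+0 : x + 1 * s ≡ W + 0 * s
          x+s≡W+0 = trans (cong (x +_) (+-identityʳ s)) (trans x+s≡W (sym (+-identityʳ W)))
      above-frob∈ : ∀ z → W ⊖ s ℤ.< z → z ∈ℤ A
      above-frob∈ (ℤ.+ x) frob<x = x , refl , AperyMax⇒∈ x (ℤP.drop‿+<+ (begin-strict
        ℤ.+ W              ≡⟨ sym frob+s≡W ⟩
        W ⊖ s ℤ.+ ℤ.+ s    <⟨ ℤP.+-monoˡ-< (ℤ.+ s) frob<x ⟩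
        ℤ.+ x ℤ.+ ℤ.+ s    ≡⟨ sym (ℤP.pos-+ x s) ⟩
        ℤ.+ (x + s)        ∎))
        where open ℤP.≤-Reasoning
      above-frob∈ -[1+ m ] frob<z = ⊥-elim (ℤP.<⇒≱ (ℤP.<-≤-trans frob<z (-≤- z≤n)) -1≤frob)

numerical-⊆ : ∀ {A B : ℕ → Set} → A ⊆ B → IsNumericalSemigroup A → IsNumericalSemigroup B
numerical-⊆ A⊆B (N , above∈) = N , λ x N≤x → A⊆B (above∈ x N≤x)

frobenius-⊆⊇ : ∀ {A B : ℕ → Set} {f} → A ⊆ B → B ⊆ A → IsFrobeniusNumber A f → IsFrobeniusNumber B f
frobenius-⊆⊇ A⊆B B⊆A (f∉A , above∈A) =
  (λ { (x , f≡x , x∈B) → f∉A (x , f≡x , B⊆A x∈B) }) ,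
  (λ z f<z → let (x , z≡x , x∈A) = above∈A z f<z in x , z≡x , A⊆B x∈A)

-- Gluing

Glue : (ℕ → Set) → (ℕ → Set) → ℕ → ℕ → ℕ → Set
Glue A B s s′ x = Σ ℕ λ a → Σ ℕ λ b → A a × B b × x ≡ s′ * a + s * b

module _ {A B : ℕ → Set} {s s′ W W′ : ℕ}
         (aperyA : AperyMax A s W) (aperyB : AperyMax B s′ W′) (cop : Coprime s s′) where
  private
    module A = AperyMax aperyA
    module B = AperyMax aperyB

  glue-cover : ∀ ρ → Σ ℕ λ x → Glue A B s s′ x × x ≤ s′ * W + s * W′ × x ≡[ s * s′ ] ρ
  glue-cover ρ with coprime⇒sum-hits-residues cop A.1≤s B.1≤s ρ
  ... | u , v , sum≡ρ with A.cover u | B.cover v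
  ... | a , a∈ , a≤ , a≡u | b , b∈ , b≤ , b≡v =
    s′ * a + s * b , (a , b , a∈ , b∈ , refl) ,
    +-mono-≤ (*-monoʳ-≤ s′ a≤) (*-monoʳ-≤ s b≤) ,
    ≡[]-trans (≡[]-+ (subst (λ m → s′ * a ≡[ m ] s′ * u) (*-comm s′ s) (≡[]-*ˡ s′ a≡u)) (≡[]-*ˡ s b≡v)) sum≡ρ

  glue-lower : ∀ x → Glue A B s s′ x → x ≡[ s * s′ ] s′ * W + s * W′ → s′ * W + s * W′ ≤ x
  glue-lower x (a , b , a∈ , b∈ , refl) (u , v , e) =
    +-mono-≤ (*-monoʳ-≤ s′ (A.lower a a∈ a≡W)) (*-monoʳ-≤ s (B.lower b b∈ b≡W′))
    where
      viaA : ∀ a b u → s′ * a + s * b + u * (s * s′) ≡ s′ * a + (b + u * s′) * s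
      viaA a b u = ring s s′ a b u
        where ring : ∀ s s′ a b u → s′ * a + s * b + u * (s * s′) ≡ s′ * a + (b + u * s′) * s
              ring = solve-∀
      viaB : ∀ a b u → s′ * a + s * b + u * (s * s′) ≡ s * b + (a + u * s) * s′
      viaB a b u = ring s s′ a b u
        where ring : ∀ s s′ a b u → s′ * a + s * b + u * (s * s′) ≡ s * b + (a + u * s) * s′
              ring = solve-∀
      a≡W : a ≡[ s ] W
      a≡W = ≡[]-cancel-coprime cop (b + u * s′ , W′ + v * s′ , trans (sym (viaA a b u)) (trans e (viaA W W′ v)))
      b≡W′ : b ≡[ s′ ] W′
      b≡W′ = ≡[]-cancel-coprime (Coprime.sym cop) (a + u * s , W + v * s , trans (sym (viaB a b u)) (trans e (viaB W W′ v)))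

  glue-AperyMax : AperyMax (Glue A B s s′) (s * s′) (s′ * W + s * W′)
  glue-AperyMax = record
    { 0∈    = 0 , 0 , A.0∈ , B.0∈ , sym (cong₂ _+_ (*-zeroʳ s′) (*-zeroʳ s))
    ; +∈    = λ { (a₁ , b₁ , a₁∈ , b₁∈ , refl) (a₂ , b₂ , a₂∈ , b₂∈ , refl) →
                  a₁ + a₂ , b₁ + b₂ , A.+∈ a₁∈ a₂∈ , B.+∈ b₁∈ b₂∈ , distrib a₁ a₂ b₁ b₂ }
    ; s∈    = s , 0 , A.s∈ , B.0∈ , trans (*-comm s s′) (sym (trans (cong (s′ * s +_) (*-zeroʳ s)) (+-identityʳ (s′ * s))))
    ; 1≤s   = *-mono-≤ A.1≤s B.1≤s
    ; s≤1+W = begin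
        s * s′                    ≤⟨ *-monoˡ-≤ s′ A.s≤1+W ⟩
        s′ + W * s′               ≡⟨ cong (s′ +_) (*-comm W s′) ⟩
        s′ + s′ * W               ≤⟨ +-monoˡ-≤ (s′ * W) s′≤1+sW′ ⟩
        suc (s * W′) + s′ * W     ≡⟨ cong suc (+-comm (s * W′) (s′ * W)) ⟩
        suc (s′ * W + s * W′)     ∎
    ; cover = glue-cover
    ; lower = glue-lower
    }
    where
      open ≤-Reasoning
      distrib : ∀ a₁ a₂ b₁ b₂ → s′ * a₁ + s * b₁ + (s′ * a₂ + s * b₂) ≡ s′ * (a₁ + a₂) + s * (b₁ + b₂)
      distrib a₁ a₂ b₁ b₂ = ring s s′ a₁ a₂ b₁ b₂
        where ring : ∀ s s′ a₁ a₂ b₁ b₂ → s′ * a₁ + s * b₁ + (s′ * a₂ + s * b₂) ≡ s′ * (a₁ + a₂) + s * (b₁ + b₂)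
              ring = solve-∀
      s′≤1+sW′ : s′ ≤ suc (s * W′)
      s′≤1+sW′ = ≤-trans B.s≤1+W (s≤s (≤-trans (m≤m*n W′ s {{>-nonZero A.1≤s}}) (≤-reflexive (*-comm W′ s))))

-- The semigroup generated by the repunits of degree at least k

module RepunitSemigroup (Q k′ : ℕ) where
  P k s r E W : ℕ
  P = suc Q
  k = suc k′
  s = repunit P k
  r = repunit P k′
  E = P ^ suc k
  W = P * r * E + s * P

  Generator : ℕ → Set
  Generator a = Σ ℕ λ e → a ≡ repunit P (k + e)

  T : ℕ → Set
  T = ⟨ Generator ⟩

  E≡Qs+1 : E ≡ Q * s + 1
  E≡Qs+1 = sym (repunit-geometric Q k)

  P≤E : P ≤ E
  P≤E = ≤-trans (≤-reflexive (sym (*-identityʳ P))) (*-monoʳ-≤ P (m^n>0 P k))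

  R*E+s*D≡R+[Q*R+D]*s : ∀ R D → R * E + s * D ≡ R + (Q * R + D) * s
  R*E+s*D≡R+[Q*R+D]*s R D = trans (cong (λ z → R * z + s * D) E≡Qs+1) (ring R Q s D)
    where ring : ∀ R Q s D → R * (Q * s + 1) + s * D ≡ R + (Q * R + D) * s
          ring = solve-∀

  -- Since E ≡ 1 mod s, the residue of R·E + s·D is that of R; the bound R ≤ r·D then forces
  -- many summands D, i.e. a large element, whenever the residue is large.
  Balanced : ℕ → Set
  Balanced x = Σ ℕ λ R → Σ ℕ λ D → x ≡ R * E + s * D × R ≤ D * r

  Balanced-+ : ∀ {x y} → Balanced x → Balanced y → Balanced (x + y)
  Balanced-+ (R₁ , D₁ , refl , R₁≤) (R₂ , D₂ , refl , R₂≤) =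
    R₁ + R₂ , D₁ + D₂ , ring R₁ R₂ D₁ D₂ E s ,
    ≤-trans (+-mono-≤ R₁≤ R₂≤) (≤-reflexive (sym (*-distribʳ-+ r D₁ D₂)))
    where ring : ∀ R₁ R₂ D₁ D₂ E s → R₁ * E + s * D₁ + (R₂ * E + s * D₂) ≡ (R₁ + R₂) * E + s * (D₁ + D₂)
          ring = solve-∀

  Balanced-*s : ∀ X → Balanced (X * s)
  Balanced-*s X = 0 , X , *-comm X s , z≤n

  -- Peel off blocks of k + 1 digits, each a multiple of s.
  Balanced-generator : ∀ fuel e → e ≤ fuel → Balanced (repunit P (k + e))
  Balanced-generator fuel zero _ =
    0 , 1 , trans (cong (repunit P) (+-identityʳ k)) (sym (*-identityʳ s)) , z≤n
  Balanced-generator fuel (suc e) _ with e ≤? k′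
  ... | yes e≤k′ = repunit P e , 1 , trans (repunit-+ P k e) (ring s E (repunit P e)) ,
                   ≤-trans (repunit-mono-≤ P e≤k′) (≤-reflexive (sym (+-identityʳ r)))
    where ring : ∀ s E x → s + E * x ≡ x * E + s * 1
          ring = solve-∀
  Balanced-generator (suc fuel) (suc e) (s≤s e≤fuel) | no e≰k′ =
    subst Balanced (sym split) (Balanced-+ (Balanced-generator fuel e″ (≤-trans (m∸n≤m e k) e≤fuel))
                                           (Balanced-*s (P ^ suc (k + e″))))
    where
      open ≡-Reasoning
      e″ = e ∸ k
      k+e″≡e : k + e″ ≡ e
      k+e″≡e = m+[n∸m]≡n (≰⇒> e≰k′)
      shuffle : ∀ k x → k + suc (k + x) ≡ (k + x) + suc k
      shuffle = solve-∀
      split : repunit P (k + suc e) ≡ repunit P (k + e″) + P ^ suc (k + e″) * s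
      split = begin
        repunit P (k + suc e)                         ≡⟨ cong (λ z → repunit P (k + suc z)) (sym k+e″≡e) ⟩
        repunit P (k + suc (k + e″))                  ≡⟨ cong (repunit P) (shuffle k e″) ⟩
        repunit P ((k + e″) + suc k)                  ≡⟨ repunit-+ P (k + e″) k ⟩
        repunit P (k + e″) + P ^ suc (k + e″) * s     ∎

  T⇒Balanced : ∀ {x} → T x → Balanced x
  T⇒Balanced zero∈                 = 0 , 0 , sym (*-zeroʳ s) , z≤n
  T⇒Balanced (gen+ (e , refl) x∈) = Balanced-+ (Balanced-generator e e ≤-refl) (T⇒Balanced x∈)

  W%s≡P*r : W % s ≡ P * r
  W%s≡P*r = begin
    W % s                                 ≡⟨ cong (_% s) (R*E+s*D≡R+[Q*R+D]*s (P * r) P) ⟩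
    (P * r + (Q * (P * r) + P) * s) % s   ≡⟨ [m+kn]%n≡m%n (P * r) (Q * (P * r) + P) s ⟩
    (P * r) % s                           ≡⟨ m<n⇒m%n≡m ≤-refl ⟩
    P * r                                 ∎
    where open ≡-Reasoning

  T-lower : ∀ a → T a → a ≡[ s ] W → W ≤ a
  T-lower a a∈ a≡W with T⇒Balanced a∈
  ... | R , D , refl , R≤Dr = by-quotient (R / s) refl
    where
      R%s≡P*r : R % s ≡ P * r
      R%s≡P*r = begin
        R % s                           ≡⟨ sym ([m+kn]%n≡m%n R (Q * R + D) s) ⟩
        (R + (Q * R + D) * s) % s       ≡⟨ cong (_% s) (sym (R*E+s*D≡R+[Q*R+D]*s R D)) ⟩
        (R * E + s * D) % s             ≡⟨ ≡[]⇒%≡ _ W s a≡W ⟩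
        W % s                           ≡⟨ W%s≡P*r ⟩
        P * r                           ∎
        where open ≡-Reasoning
      R≡ : R ≡ P * r + R / s * s
      R≡ = trans (m≡m%n+[m/n]*n R s) (cong (_+ R / s * s) R%s≡P*r)
      by-quotient : ∀ j → R / s ≡ j → W ≤ R * E + s * D
      by-quotient zero R/s≡0 = begin
          P * r * E + s * P ≤⟨ +-monoʳ-≤ (P * r * E) (*-monoʳ-≤ s P≤D) ⟩
          P * r * E + s * D ≡⟨ cong (λ z → z * E + s * D) (sym R≡Pr) ⟩
          R * E + s * D     ∎
        where
          open ≤-Reasoning
          R≡Pr : R ≡ P * r
          R≡Pr = trans R≡ (trans (cong (λ z → P * r + z * s) R/s≡0) (+-identityʳ _))
          P≤D : P ≤ D
          P≤D = *-cancelʳ-≤ P D r {{>-nonZero (repunit>0 P k′)}} (≤-trans (≤-reflexive (sym R≡Pr)) R≤Dr)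
      by-quotient (suc j) R/s≡1+j = begin
          P * r * E + s * P           ≤⟨ +-monoʳ-≤ (P * r * E) (*-monoʳ-≤ s P≤E) ⟩
          P * r * E + s * E           ≡⟨ sym (*-distribʳ-+ E (P * r) s) ⟩
          (P * r + s) * E             ≤⟨ *-monoˡ-≤ E (+-monoʳ-≤ (P * r) (m≤m+n s (j * s))) ⟩
          (P * r + suc j * s) * E     ≡⟨ cong (λ z → (P * r + z * s) * E) (sym R/s≡1+j) ⟩
          (P * r + R / s * s) * E     ≡⟨ cong (_* E) (sym R≡) ⟩
          R * E                       ≤⟨ m≤m+n (R * E) (s * D) ⟩
          R * E + s * D               ∎
        where open ≤-Reasoning

  repunitSum : List ℕ → ℕ
  repunitSum []      = 0
  repunitSum (j ∷ L) = repunit P j + repunitSum L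

  repunitSum-replicate : ∀ n j → repunitSum (replicate n j) ≡ n * repunit P j
  repunitSum-replicate zero    j = refl
  repunitSum-replicate (suc n) j = cong (repunit P j +_) (repunitSum-replicate n j)

  repunitSum-++ : ∀ L₁ L₂ → repunitSum (L₁ ++ L₂) ≡ repunitSum L₁ + repunitSum L₂
  repunitSum-++ []       L₂ = refl
  repunitSum-++ (j ∷ L₁) L₂ = trans (cong (repunit P j +_) (repunitSum-++ L₁ L₂)) (sym (+-assoc (repunit P j) _ _))

  -- Start from P·r, i.e. P copies of repunit k′, and lower the total one unit at a time: either
  -- drop a summand repunit 0 = 1, or replace repunit (j + 1) = 1 + P·repunit j by P copies of
  -- repunit j, which costs Q further summands.
  repunitSum-short : ∀ d ρ → ρ + d ≡ P * r → Σ (List ℕ) λ L → repunitSum L ≡ ρ × length L ≤ P + Q * d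
  repunitSum-short zero ρ ρ+0≡Pr =
    replicate P k′ , trans (repunitSum-replicate P k′) (sym (trans (sym (+-identityʳ ρ)) ρ+0≡Pr)) ,
    ≤-trans (≤-reflexive (length-replicate P)) (m≤m+n P (Q * 0))
  repunitSum-short (suc d) ρ ρ+1+d≡Pr with repunitSum-short d (suc ρ) (trans (sym (+-suc ρ d)) ρ+1+d≡Pr)
  ... | [] , () , _
  ... | zero ∷ L , sum≡ , len≤ =
    L , suc-injective sum≡ , ≤-trans (n≤1+n _) (≤-trans len≤ (+-monoʳ-≤ P (*-monoʳ-≤ Q (n≤1+n d))))
  ... | suc j ∷ L , sum≡ , len≤ =
    replicate P j ++ L ,
    trans (repunitSum-++ (replicate P j) L) (trans (cong (_+ repunitSum L) (repunitSum-replicate P j)) (suc-injective sum≡)) ,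
    (begin
      length (replicate P j ++ L)         ≡⟨ length-++ (replicate P j) ⟩
      length (replicate P j) + length L   ≡⟨ cong (_+ length L) (length-replicate P) ⟩
      P + length L                        ≡⟨ sym (+-suc Q (length L)) ⟩
      Q + suc (length L)                  ≤⟨ +-monoʳ-≤ Q len≤ ⟩
      Q + (P + Q * d)                     ≡⟨ ring Q d ⟩
      P + Q * suc d                       ∎)
    where open ≤-Reasoning
          ring : ∀ Q d → Q + ((1 + Q) + Q * d) ≡ (1 + Q) + Q * (1 + d)
          ring = solve-∀

  repunitSum∈T : ∀ L → T (repunitSum L * E + s * length L)
  repunitSum∈T []      = subst T (sym (*-zeroʳ s)) zero∈
  repunitSum∈T (j ∷ L) = subst T (sym split) (gen+ (suc j , refl) (repunitSum∈T L))
    where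
      ring : ∀ x X E s n → (x + X) * E + s * (1 + n) ≡ (s + E * x) + (X * E + s * n)
      ring = solve-∀
      split : (repunit P j + repunitSum L) * E + s * suc (length L) ≡ repunit P (k + suc j) + (repunitSum L * E + s * length L)
      split = trans (ring (repunit P j) (repunitSum L) E s (length L))
                    (cong (_+ (repunitSum L * E + s * length L)) (sym (repunit-+ P k j)))

  T-cover : ∀ ρ → Σ ℕ λ a → T a × a ≤ W × a ≡[ s ] ρ
  T-cover ρ with repunitSum-short (P * r ∸ ρ % s) (ρ % s) (m+[n∸m]≡n ρ%s≤Pr)
    where ρ%s≤Pr : ρ % s ≤ P * r
          ρ%s≤Pr = s≤s⁻¹ (m%n<n ρ s)
  ... | L , sum≡ , len≤ = repunitSum L * E + s * length L , repunitSum∈T L , a≤W , a≡ρ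
    where
      ρ′ = ρ % s
      d = P * r ∸ ρ′
      sQ≤E : s * Q ≤ E
      sQ≤E = ≤-trans (≤-reflexive (*-comm s Q)) (≤-trans (m≤m+n (Q * s) 1) (≤-reflexive (sym E≡Qs+1)))
      expand : ∀ x E s P Q d → x * E + s * (P + Q * d) ≡ x * E + s * P + (s * Q) * d
      expand = solve-∀
      collect : ∀ x E s P d → x * E + s * P + E * d ≡ (x + d) * E + s * P
      collect = solve-∀
      a≤W : repunitSum L * E + s * length L ≤ W
      a≤W = begin
        repunitSum L * E + s * length L    ≡⟨ cong (λ z → z * E + s * length L) sum≡ ⟩
        ρ′ * E + s * length L              ≤⟨ +-monoʳ-≤ (ρ′ * E) (*-monoʳ-≤ s len≤) ⟩
        ρ′ * E + s * (P + Q * d)           ≡⟨ expand ρ′ E s P Q d ⟩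
        ρ′ * E + s * P + (s * Q) * d       ≤⟨ +-monoʳ-≤ (ρ′ * E + s * P) (*-monoˡ-≤ d sQ≤E) ⟩
        ρ′ * E + s * P + E * d             ≡⟨ collect ρ′ E s P d ⟩
        (ρ′ + d) * E + s * P               ≡⟨ cong (λ z → z * E + s * P) (m+[n∸m]≡n (s≤s⁻¹ (m%n<n ρ s))) ⟩
        W                                  ∎
        where open ≤-Reasoning
      a≡ρ : repunitSum L * E + s * length L ≡[ s ] ρ
      a≡ρ = %≡⇒≡[] _ ρ s (begin
        (repunitSum L * E + s * length L) % s                                     ≡⟨ cong (_% s) (R*E+s*D≡R+[Q*R+D]*s (repunitSum L) (length L)) ⟩
        (repunitSum L + (Q * repunitSum L + length L) * s) % s                    ≡⟨ [m+kn]%n≡m%n (repunitSum L) (Q * repunitSum L + length L) s ⟩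
        repunitSum L % s                                                          ≡⟨ cong (_% s) sum≡ ⟩
        ρ % s % s                                                                 ≡⟨ m%n%n≡m%n ρ s ⟩
        ρ % s                                                                     ∎)
        where open ≡-Reasoning

  E*E≡W*Q+P : E * E ≡ W * Q + P
  E*E≡W*Q+P = begin
    E * E                                           ≡⟨ cong₂ _*_ E≡ E≡ ⟩
    P * (Q * r + 1) * (P * (Q * r + 1))             ≡⟨ ring Q r ⟩
    (P * r * (P * (Q * r + 1)) + s * P) * Q + P     ≡⟨ cong (λ z → (P * r * z + s * P) * Q + P) (sym E≡) ⟩
    W * Q + P                                       ∎
    where
      open ≡-Reasoning
      E≡ : E ≡ P * (Q * r + 1)
      E≡ = cong (P *_) (sym (repunit-geometric Q k′))
      ring : ∀ Q r → (1 + Q) * (Q * r + 1) * ((1 + Q) * (Q * r + 1)) ≡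
                     ((1 + Q) * r * ((1 + Q) * (Q * r + 1)) + (1 + (1 + Q) * r) * (1 + Q)) * Q + (1 + Q)
      ring = solve-∀

  T-AperyMax : AperyMax T s W
  T-AperyMax = record
    { 0∈    = zero∈
    ; +∈    = ⟨⟩-+
    ; s∈    = subst T (+-identityʳ s) (gen+ (0 , cong (repunit P) (sym (+-identityʳ k))) zero∈)
    ; 1≤s   = s≤s z≤n
    ; s≤1+W = ≤-trans (m≤m*n s P) (≤-trans (m≤n+m (s * P) (P * r * E)) (n≤1+n W))
    ; cover = T-cover
    ; lower = T-lower
    }

prime∤⇒coprime : ∀ {p d} → Prime p → ¬ p ∣ d → Coprime p d
prime∤⇒coprime p-prime p∤d (c∣p , c∣d) with prime⇒irreducible p-prime c∣p
... | inj₁ c≡1 = c≡1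
... | inj₂ refl = ⊥-elim (p∤d c∣d)

-- Divisor sums

sum-map-setEq : ∀ (f : ℕ → ℕ) {xs ys} → Unique xs → Unique ys →
                (∀ {z} → z ∈ xs → z ∈ ys) → (∀ {z} → z ∈ ys → z ∈ xs) →
                sum (map f xs) ≡ sum (map f ys)
sum-map-setEq f xs! ys! to from = sum-↭ (Perm.map⁺ f (∼bag⇒↭ (unique∧set⇒bag xs! ys! (mk⇔ to from))))

range1-unique : ∀ n → Unique (range1 n)
range1-unique n = Unique.applyUpTo⁺₁ suc n (λ i<j _ eq → <⇒≢ i<j (suc-injective eq))

∈-range1 : ∀ {x n} → 1 ≤ x → x ≤ n → x ∈ range1 n
∈-range1 {suc x} _ x≤n = ∈-applyUpTo⁺ suc x≤n

divisors : ℕ → List ℕ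
divisors X = filter (_∣? X) (range1 X)

divisors-unique : ∀ X → Unique (divisors X)
divisors-unique X = Unique.filter⁺ (_∣? X) (range1-unique X)

∈-divisors⁻ : ∀ {X d} → d ∈ divisors X → d ∣ X
∈-divisors⁻ {X} d∈ = proj₂ (∈-filter⁻ (_∣? X) {xs = range1 X} d∈)

∈-divisors⁺ : ∀ {X d} .{{_ : NonZero X}} → d ∣ X → d ∈ divisors X
∈-divisors⁺ {X}     {zero}  0∣X with () ← ≢-nonZero⁻¹ X (0∣⇒≡0 0∣X)
∈-divisors⁺ {X}     {suc i} d∣X = ∈-filter⁺ (_∣? X) (∈-range1 (s≤s z≤n) (∣⇒≤ d∣X)) d∣X

^-distribʳ-* : ∀ a b t → (a * b) ^ t ≡ a ^ t * b ^ t
^-distribʳ-* a b zero    = refl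
^-distribʳ-* a b (suc t) rewrite ^-distribʳ-* a b t = ring a b (a ^ t) (b ^ t)
  where ring : ∀ a b x y → a * b * (x * y) ≡ a * x * (b * y)
        ring = solve-∀

sum-map-^-scale : ∀ p t D → sum (map (_^ t) (map (p *_) D)) ≡ p ^ t * sum (map (_^ t) D)
sum-map-^-scale p t []      = sym (*-zeroʳ (p ^ t))
sum-map-^-scale p t (d ∷ D) rewrite sum-map-^-scale p t D | ^-distribʳ-* p d t =
  sym (*-distribˡ-+ (p ^ t) (d ^ t) (sum (map (_^ t) D)))

module _ (t : ℕ) {p : ℕ} (p-prime : Prime p) where
  private instance
    p≢0 : NonZero p
    p≢0 = prime⇒nonZero p-prime

  ∤∧∣p^e*m⇒∣m : ∀ {d m} e → ¬ p ∣ d → d ∣ p ^ e * m → d ∣ m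
  ∤∧∣p^e*m⇒∣m {d} {m} zero    _   d∣ = subst (d ∣_) (+-identityʳ m) d∣
  ∤∧∣p^e*m⇒∣m {d} {m} (suc e) p∤d d∣ =
    ∤∧∣p^e*m⇒∣m e p∤d (coprime-divisor (Coprime.sym (prime∤⇒coprime p-prime p∤d)) (subst (d ∣_) (*-assoc p (p ^ e) m) d∣))

  -- The divisors of p^(e+1)·m are those of m (not divisible by p) and p times those of p^e·m.
  σ-p*-step : ∀ e m .{{_ : NonZero m}} → ¬ p ∣ m → σ t (p ^ suc e * m) ≡ σ t m + p ^ t * σ t (p ^ e * m)
  σ-p*-step e m p∤m = begin
      σ t X                                                     ≡⟨ sum-map-setEq (_^ t) (divisors-unique X) L-unique to from ⟩
      sum (map (_^ t) L)                                        ≡⟨ cong sum (map-++ (_^ t) (divisors m) (map (p *_) (divisors Y))) ⟩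
      sum (map (_^ t) (divisors m) ++ map (_^ t) (map (p *_) (divisors Y)))
                                                                ≡⟨ sum-++ (map (_^ t) (divisors m)) _ ⟩
      σ t m + sum (map (_^ t) (map (p *_) (divisors Y)))        ≡⟨ cong (σ t m +_) (sum-map-^-scale p t (divisors Y)) ⟩
      σ t m + p ^ t * σ t Y                                     ∎
    where
      open ≡-Reasoning
      X = p ^ suc e * m
      Y = p ^ e * m
      instance
        Y≢0 : NonZero Y
        Y≢0 = m*n≢0 (p ^ e) m {{m^n≢0 p e}}
        X≢0 : NonZero X
        X≢0 = m*n≢0 (p ^ suc e) m {{m^n≢0 p (suc e)}}
      X≡p*Y : X ≡ p * Y
      X≡p*Y = *-assoc p (p ^ e) m
      L = divisors m ++ map (p *_) (divisors Y)
      disjoint : ∀ {v} → ¬ (v ∈ divisors m × v ∈ map (p *_) (divisors Y))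
      disjoint (v∈ , v∈p*) with ∈-map⁻ (p *_) v∈p*
      ... | d , _ , refl = p∤m (∣-trans (m∣m*n d) (∈-divisors⁻ v∈))
      L-unique : Unique L
      L-unique = Unique.++⁺ (divisors-unique m) (Unique.map⁺ (*-cancelˡ-≡ _ _ p) (divisors-unique Y)) disjoint
      to : ∀ {z} → z ∈ divisors X → z ∈ L
      to {z} z∈ with p ∣? z
      ... | yes (divides q z≡qp) =
        ∈-++⁺ʳ (divisors m) (subst (_∈ map (p *_) (divisors Y)) (sym z≡pq) (∈-map⁺ (p *_) (∈-divisors⁺ q∣Y)))
        where
          z≡pq : z ≡ p * q
          z≡pq = trans z≡qp (*-comm q p)
          q∣Y : q ∣ Y
          q∣Y = *-cancelˡ-∣ p (subst₂ _∣_ z≡pq X≡p*Y (∈-divisors⁻ z∈))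
      ... | no p∤z = ∈-++⁺ˡ (∈-divisors⁺ (∤∧∣p^e*m⇒∣m (suc e) p∤z (∈-divisors⁻ z∈)))
      from : ∀ {z} → z ∈ L → z ∈ divisors X
      from z∈ with ∈-++⁻ (divisors m) z∈
      ... | inj₁ z∈m = ∈-divisors⁺ (∣n⇒∣m*n (p ^ suc e) (∈-divisors⁻ z∈m))
      ... | inj₂ z∈p* with ∈-map⁻ (p *_) z∈p*
      ...   | d , d∈ , refl = ∈-divisors⁺ (subst (p * d ∣_) (sym X≡p*Y) (*-monoʳ-∣ p (∈-divisors⁻ d∈)))

  σ-p^e* : ∀ e m .{{_ : NonZero m}} → ¬ p ∣ m → σ t (p ^ e * m) ≡ repunit (p ^ t) e * σ t m
  σ-p^e* zero    m p∤m = trans (cong (σ t) (+-identityʳ m)) (sym (+-identityʳ (σ t m)))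
  σ-p^e* (suc e) m p∤m rewrite σ-p*-step e m p∤m | σ-p^e* e m p∤m = ring (σ t m) (p ^ t) (repunit (p ^ t) e)
    where ring : ∀ S P x → S + P * (x * S) ≡ (1 + P * x) * S
          ring = solve-∀

prime>1 : ∀ {p} → Prime p → 1 < p
prime>1 {p} p-prime = nonTrivial⇒n>1 p {{prime⇒nonTrivial p-prime}}

prime∤1 : ∀ {p} → Prime p → ¬ p ∣ 1
prime∤1 p-prime p∣1 = <⇒≢ (prime>1 p-prime) (sym (∣1⇒≡1 p∣1))

prime∤* : ∀ {p a b} → Prime p → ¬ p ∣ a → ¬ p ∣ b → ¬ p ∣ a * b
prime∤* {a = a} {b} p-prime p∤a p∤b p∣ab with euclidsLemma a b p-prime p∣ab
... | inj₁ p∣a = p∤a p∣a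
... | inj₂ p∣b = p∤b p∣b

prime∣^⇒∣ : ∀ {p q} e → Prime p → p ∣ q ^ e → p ∣ q
prime∣^⇒∣         zero    p-prime p∣1 = ⊥-elim (prime∤1 p-prime p∣1)
prime∣^⇒∣ {q = q} (suc e) p-prime p∣ with euclidsLemma q (q ^ e) p-prime p∣
... | inj₁ p∣q   = p∣q
... | inj₂ p∣q^e = prime∣^⇒∣ e p-prime p∣q^e

prime∣prime⇒≡ : ∀ {p q} → Prime p → Prime q → p ∣ q → p ≡ q
prime∣prime⇒≡ p-prime q-prime p∣q with prime⇒irreducible q-prime p∣q
... | inj₁ p≡1 = ⊥-elim (<⇒≢ (prime>1 p-prime) (sym p≡1))
... | inj₂ p≡q = p≡q

prime∤prime^ : ∀ {p q} e → Prime p → Prime q → p ≢ q → ¬ p ∣ q ^ e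
prime∤prime^ e p-prime q-prime p≢q p∣ = p≢q (prime∣prime⇒≡ p-prime q-prime (prime∣^⇒∣ e p-prime p∣))

σ-1 : ∀ t → σ t 1 ≡ 1
σ-1 t = trans (+-identityʳ (1 ^ t)) (^-zeroˡ t)

-- Gluing along the prime powers of n

module PrimePowerGluing (t : ℕ) where

  -- p ^ t is written suc (Q p), the form in which RepunitSemigroup takes its base.
  Q : ℕ → ℕ
  Q p = p ^ t ∸ 1

  suc-Q≡p^t : ∀ {p} → Prime p → suc (Q p) ≡ p ^ t
  suc-Q≡p^t {p} p-prime = trans (+-comm 1 (Q p)) (m∸n+n≡m (m^n>0 p {{prime⇒nonZero p-prime}} t))

  s : ℕ → ℕ → ℕ
  s p k = repunit (suc (Q p)) k

  repunit-p^t≡s : ∀ {p} → Prime p → ∀ k → repunit (p ^ t) k ≡ s p k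
  repunit-p^t≡s p-prime k = cong (λ P → repunit P k) (sym (suc-Q≡p^t p-prime))

  -- The case k = 0 never occurs in an admissible list.
  W : ℕ → ℕ → ℕ
  W p zero     = 0
  W p (suc k′) = RepunitSemigroup.W (Q p) k′

  T : ℕ → ℕ → ℕ → Set
  T p zero     = λ _ → ⊤
  T p (suc k′) = RepunitSemigroup.T (Q p) k′

  prodPow : List (ℕ × ℕ) → ℕ
  prodPow []            = 1
  prodPow ((p , k) ∷ L) = p ^ k * prodPow L

  prodRep : List (ℕ × ℕ) → ℕ
  prodRep []            = 1
  prodRep ((p , k) ∷ L) = s p k * prodRep L

  gluedW : List (ℕ × ℕ) → ℕ
  gluedW []            = 0
  gluedW ((p , k) ∷ L) = prodRep L * W p k + s p k * gluedW L

  Glued : List (ℕ × ℕ) → ℕ → Set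
  Glued []            = λ _ → ⊤
  Glued ((p , k) ∷ L) = Glue (T p k) (Glued L) (s p k) (prodRep L)

  Admissible : List (ℕ × ℕ) → Set
  Admissible []            = ⊤
  Admissible ((p , k) ∷ L) =
    Prime p × 1 ≤ k × All (λ e → p ≢ proj₁ e) L × Coprime (s p k) (prodRep L) × Admissible L

  ℕ-AperyMax : AperyMax (λ _ → ⊤) 1 0
  ℕ-AperyMax = record
    { 0∈ = tt ; +∈ = λ _ _ → tt ; s∈ = tt ; 1≤s = ≤-refl ; s≤1+W = ≤-refl
    ; cover = λ ρ → 0 , tt , z≤n , ρ , 0 , trans (*-identityʳ ρ) (sym (+-identityʳ ρ))
    ; lower = λ _ _ _ → z≤n }

  Glued-AperyMax : ∀ L → Admissible L → AperyMax (Glued L) (prodRep L) (gluedW L)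
  Glued-AperyMax []                  _                      = ℕ-AperyMax
  Glued-AperyMax ((p , suc k′) ∷ L) (_ , _ , _ , cop , adm) =
    glue-AperyMax (RepunitSemigroup.T-AperyMax (Q p) k′) (Glued-AperyMax L adm) cop

  admissible⇒primes : ∀ L → Admissible L → All (λ e → Prime (proj₁ e)) L
  admissible⇒primes []            _                        = []
  admissible⇒primes ((p , k) ∷ L) (p-prime , _ , _ , _ , adm) = p-prime ∷ admissible⇒primes L adm

  prodPow≢0 : ∀ L → Admissible L → NonZero (prodPow L)
  prodPow≢0 []            _ = _
  prodPow≢0 ((p , k) ∷ L) (p-prime , _ , _ , _ , adm) =
    m*n≢0 (p ^ k) (prodPow L) {{m^n≢0 p k {{prime⇒nonZero p-prime}}}} {{prodPow≢0 L adm}}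

  ∤prodPow : ∀ {p} L → Prime p → All (λ e → p ≢ proj₁ e) L → Admissible L → ¬ p ∣ prodPow L
  ∤prodPow []             p-prime _           _ = prime∤1 p-prime
  ∤prodPow ((q , k) ∷ L) p-prime (p≢q ∷ p≢L) (q-prime , _ , _ , _ , adm) =
    prime∤* p-prime (prime∤prime^ k p-prime q-prime p≢q) (∤prodPow L p-prime p≢L adm)

  σ-prodPow* : ∀ L → Admissible L → ∀ m .{{_ : NonZero m}} → All (λ e → ¬ proj₁ e ∣ m) L →
               σ t (prodPow L * m) ≡ prodRep L * σ t m
  σ-prodPow* [] _ m _ = trans (cong (σ t) (*-identityˡ m)) (sym (*-identityˡ (σ t m)))
  σ-prodPow* ((p , k) ∷ L) (p-prime , _ , p≢L , _ , adm) m (p∤m ∷ L∤m) = begin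
      σ t (p ^ k * prodPow L * m)           ≡⟨ cong (σ t) (*-assoc (p ^ k) (prodPow L) m) ⟩
      σ t (p ^ k * (prodPow L * m))         ≡⟨ σ-p^e* t p-prime k (prodPow L * m) {{m*n≢0 _ m {{prodPow≢0 L adm}}}}
                                                 (prime∤* p-prime (∤prodPow L p-prime p≢L adm) p∤m) ⟩
      repunit (p ^ t) k * σ t (prodPow L * m) ≡⟨ cong₂ _*_ (repunit-p^t≡s p-prime k) (σ-prodPow* L adm m L∤m) ⟩
      s p k * (prodRep L * σ t m)           ≡⟨ sym (*-assoc (s p k) (prodRep L) (σ t m)) ⟩
      s p k * prodRep L * σ t m             ∎
    where open ≡-Reasoning

  σ-prodPow : ∀ L → Admissible L → σ t (prodPow L) ≡ prodRep L
  σ-prodPow L adm = begin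
      σ t (prodPow L)       ≡⟨ cong (σ t) (sym (*-identityʳ (prodPow L))) ⟩
      σ t (prodPow L * 1)   ≡⟨ σ-prodPow* L adm 1 (All.map prime∤1 (admissible⇒primes L adm)) ⟩
      prodRep L * σ t 1     ≡⟨ cong (prodRep L *_) (σ-1 t) ⟩
      prodRep L * 1         ≡⟨ *-identityʳ (prodRep L) ⟩
      prodRep L             ∎
    where open ≡-Reasoning

  private
    p^k*X*p^e≡p^[k+e]*X : ∀ p k e X → p ^ k * X * p ^ e ≡ p ^ (k + e) * X
    p^k*X*p^e≡p^[k+e]*X p k e X rewrite ^-distribˡ-+-* p k e = ring (p ^ k) (p ^ e) X
      where ring : ∀ a b X → a * X * b ≡ a * b * X
            ring = solve-∀

  generator∈Glued : ∀ L → Admissible L → ∀ q → IsPrimePower q → Glued L (σ t (prodPow L * q))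
  generator∈Glued []                  _ _ _ = tt
  generator∈Glued ((p , suc k′) ∷ L) (p-prime , _ , p≢L , _ , adm) q q-pp = by-base q-pp
    where
      k = suc k′
      instance
        prodPow-L≢0 : NonZero (prodPow L)
        prodPow-L≢0 = prodPow≢0 L adm
      coprime-part : ∀ q .{{_ : NonZero q}} → ¬ p ∣ q → Glued L (σ t (prodPow L * q)) →
                     Glued ((p , k) ∷ L) (σ t (p ^ k * prodPow L * q))
      coprime-part q p∤q x∈ = 0 , σ t (prodPow L * q) , zero∈ , x∈ , (begin
          σ t (p ^ k * prodPow L * q)                 ≡⟨ cong (σ t) (*-assoc (p ^ k) (prodPow L) q) ⟩
          σ t (p ^ k * (prodPow L * q))               ≡⟨ σ-p^e* t p-prime k (prodPow L * q) {{m*n≢0 (prodPow L) q}}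
                                                           (prime∤* p-prime (∤prodPow L p-prime p≢L adm) p∤q) ⟩
          repunit (p ^ t) k * σ t (prodPow L * q)     ≡⟨ cong (_* σ t (prodPow L * q)) (repunit-p^t≡s p-prime k) ⟩
          s p k * σ t (prodPow L * q)                 ≡⟨ cong (_+ s p k * σ t (prodPow L * q)) (sym (*-zeroʳ (prodRep L))) ⟩
          prodRep L * 0 + s p k * σ t (prodPow L * q) ∎)
        where open ≡-Reasoning
      by-base : IsPrimePower q → Glued ((p , k) ∷ L) (σ t (p ^ k * prodPow L * q))
      by-base (inj₁ refl) = coprime-part 1 (prime∤1 p-prime) (generator∈Glued L adm 1 (inj₁ refl))
      by-base (inj₂ (p′ , e , p′-prime , 1≤e , refl)) with p′ ≟ p
      ... | no p′≢p = coprime-part (p′ ^ e) {{m^n≢0 p′ e {{prime⇒nonZero p′-prime}}}}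
                        (prime∤prime^ e p-prime p′-prime (p′≢p ∘ sym))
                        (generator∈Glued L adm _ (inj₂ (p′ , e , p′-prime , 1≤e , refl)))
      ... | yes refl = repunit (suc (Q p)) (k + e) , 0 ,
                       subst (RepunitSemigroup.T (Q p) k′) (+-identityʳ _) (gen+ (e , refl) zero∈) ,
                       AperyMax.0∈ (Glued-AperyMax L adm) , (begin
          σ t (p ^ k * prodPow L * p ^ e)                         ≡⟨ cong (σ t) (p^k*X*p^e≡p^[k+e]*X p k e (prodPow L)) ⟩
          σ t (p ^ (k + e) * prodPow L)                           ≡⟨ σ-p^e* t p-prime (k + e) (prodPow L) (∤prodPow L p-prime p≢L adm) ⟩
          repunit (p ^ t) (k + e) * σ t (prodPow L)               ≡⟨ cong₂ _*_ (repunit-p^t≡s p-prime (k + e)) (σ-prodPow L adm) ⟩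
          s p (k + e) * prodRep L                                 ≡⟨ *-comm _ (prodRep L) ⟩
          prodRep L * s p (k + e)                                 ≡⟨ sym (+-identityʳ _) ⟩
          prodRep L * s p (k + e) + 0                             ≡⟨ cong (prodRep L * s p (k + e) +_) (sym (*-zeroʳ (s p k))) ⟩
          prodRep L * s p (k + e) + s p k * 0                     ∎)
        where open ≡-Reasoning

  S⊆Glued : ∀ L → Admissible L → S (prodPow L) t ⊆ Glued L
  S⊆Glued L adm zero∈ = AperyMax.0∈ (Glued-AperyMax L adm)
  S⊆Glued L adm (gen+ (m , q , _ , q-pp , refl , refl) x∈) =
    AperyMax.+∈ (Glued-AperyMax L adm) (generator∈Glued L adm q q-pp) (S⊆Glued L adm x∈)

  ∤-p^k* : ∀ {p u} k L → Prime p → All (λ e → p ≢ proj₁ e) L → Admissible L →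
           All (λ e → ¬ proj₁ e ∣ u) L → All (λ e → ¬ proj₁ e ∣ p ^ k * u) L
  ∤-p^k* k []            _       _           _                        _             = []
  ∤-p^k* k ((q , l) ∷ L) p-prime (p≢q ∷ p≢L) (q-prime , _ , _ , _ , adm) (q∤u ∷ L∤u) =
    prime∤* q-prime (prime∤prime^ k q-prime p-prime (p≢q ∘ sym)) q∤u ∷ ∤-p^k* k L p-prime p≢L adm L∤u

  scaled-T⊆S : ∀ {p k′} L → Admissible ((p , suc k′) ∷ L) → ∀ u .{{_ : NonZero u}} → ¬ p ∣ u →
               All (λ e → ¬ proj₁ e ∣ u) L → ∀ {a} → RepunitSemigroup.T (Q p) k′ a →
               S (u * (p ^ suc k′ * prodPow L)) t (σ t u * prodRep L * a)
  scaled-T⊆S {p} {k′} L (p-prime , _ , p≢L , _ , adm) u p∤u L∤u = ⟨⟩-scale (σ t u * prodRep L) scaled-generator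
    where
      k = suc k′
      instance
        _ : NonZero (prodPow L)
        _ = prodPow≢0 L adm
        _ : NonZero p
        _ = prime⇒nonZero p-prime
        _ : NonZero (p ^ k * prodPow L)
        _ = m*n≢0 (p ^ k) (prodPow L) {{m^n≢0 p k}}
      n*p^e≡ : ∀ e → u * (p ^ k * prodPow L) * p ^ e ≡ p ^ (k + e) * (u * prodPow L)
      n*p^e≡ e rewrite ^-distribˡ-+-* p k e = ring u (p ^ k) (p ^ e) (prodPow L)
        where ring : ∀ u a b X → u * (a * X) * b ≡ a * b * (u * X)
              ring = solve-∀
      p^e-pp : ∀ e → IsPrimePower (p ^ e)
      p^e-pp zero    = inj₁ refl
      p^e-pp (suc e) = inj₂ (p , suc e , p-prime , s≤s z≤n , refl)
      scaled-generator : ∀ {g} → RepunitSemigroup.Generator (Q p) k′ g →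
                         IsGenerator (u * (p ^ k * prodPow L)) t (σ t u * prodRep L * g)
      scaled-generator (e , refl) =
        u * (p ^ k * prodPow L) * p ^ e , p ^ e ,
        >-nonZero⁻¹ _ {{m*n≢0 _ (p ^ e) {{m*n≢0 u _}} {{m^n≢0 p e}}}} ,
        p^e-pp e , refl , (begin
          σ t u * prodRep L * s p (k + e)                 ≡⟨ ring (σ t u) (prodRep L) (s p (k + e)) ⟩
          s p (k + e) * (prodRep L * σ t u)               ≡⟨ cong₂ _*_ (sym (repunit-p^t≡s p-prime (k + e))) (sym (σ-prodPow* L adm u L∤u)) ⟩
          repunit (p ^ t) (k + e) * σ t (prodPow L * u)   ≡⟨ cong (λ z → repunit (p ^ t) (k + e) * σ t z) (*-comm (prodPow L) u) ⟩
          repunit (p ^ t) (k + e) * σ t (u * prodPow L)   ≡⟨ sym (σ-p^e* t p-prime (k + e) (u * prodPow L) {{m*n≢0 u _}}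
                                                                 (prime∤* p-prime p∤u (∤prodPow L p-prime p≢L adm))) ⟩
          σ t (p ^ (k + e) * (u * prodPow L))             ≡⟨ cong (σ t) (sym (n*p^e≡ e)) ⟩
          σ t (u * (p ^ k * prodPow L) * p ^ e)           ∎)
        where
          open ≡-Reasoning
          ring : ∀ x N y → x * N * y ≡ y * (N * x)
          ring = solve-∀

  -- Scaling by the σ of a cofactor u coprime to the primes of L is what lets the induction step
  -- absorb p ^ k into u.
  Glued⊆S : ∀ L → Admissible L → ∀ u .{{_ : NonZero u}} → All (λ e → ¬ proj₁ e ∣ u) L →
            ∀ {x} → Glued L x → S (u * prodPow L) t (σ t u * x)
  Glued⊆S [] _ u _ {x} _ = subst (S (u * 1) t) x*σu≡σu*x (⟨⟩-multiple σu-generator x)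
    where
      σu-generator : IsGenerator (u * 1) t (σ t (u * 1 * 1))
      σu-generator = u * 1 * 1 , 1 , >-nonZero⁻¹ (u * 1 * 1) {{m*n≢0 (u * 1) 1 {{m*n≢0 u 1}}}} , inj₁ refl , refl , refl
      x*σu≡σu*x : x * σ t (u * 1 * 1) ≡ σ t u * x
      x*σu≡σu*x = trans (cong (λ z → x * σ t z) (trans (*-identityʳ (u * 1)) (*-identityʳ u))) (*-comm x (σ t u))
  Glued⊆S ((p , suc k′) ∷ L) adm@(p-prime , _ , p≢L , _ , adm-L) u (p∤u ∷ L∤u) (a , b , a∈T , b∈Glued , refl) =
    subst (S (u * (p ^ k * prodPow L)) t) (sym split)
          (⟨⟩-+ (scaled-T⊆S L adm u p∤u L∤u a∈T) scaled-Glued)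
    where
      k = suc k′
      split : σ t u * (prodRep L * a + s p k * b) ≡ σ t u * prodRep L * a + σ t u * s p k * b
      split = ring (σ t u) (prodRep L) a (s p k) b
        where ring : ∀ x N a s b → x * (N * a + s * b) ≡ x * N * a + x * s * b
              ring = solve-∀
      scaled-Glued : S (u * (p ^ k * prodPow L)) t (σ t u * s p k * b)
      scaled-Glued = subst₂ (λ m y → S m t y) (ring (p ^ k) u (prodPow L)) σ-p^k*u*b
                       (Glued⊆S L adm-L (p ^ k * u) {{m*n≢0 (p ^ k) u {{m^n≢0 p k {{prime⇒nonZero p-prime}}}}}}
                                (∤-p^k* k L p-prime p≢L adm-L L∤u) b∈Glued)
        where
          ring : ∀ a u X → a * u * X ≡ u * (a * X)
          ring = solve-∀
          σ-p^k*u*b : σ t (p ^ k * u) * b ≡ σ t u * s p k * b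
          σ-p^k*u*b = cong (_* b) (trans (σ-p^e* t p-prime k u p∤u)
                                         (trans (cong (_* σ t u) (repunit-p^t≡s p-prime k)) (*-comm (s p k) (σ t u))))

-- The exact prime powers of n

concatMap-unique : ∀ {A B : Set} (f : A → List B) (tag : B → A) → (∀ x {y} → y ∈ f x → tag y ≡ x) →
                   ∀ {xs} → Unique xs → (∀ x → Unique (f x)) → Unique (concatMap f xs)
concatMap-unique f tag tag-f {[]}     _            _   = []
concatMap-unique f tag tag-f {x ∷ xs} (x∉xs ∷ xs!) f!  =
  Unique.++⁺ (f! x) (concatMap-unique f tag tag-f xs! f!) disjoint
  where
    disjoint : ∀ {v} → ¬ (v ∈ f x × v ∈ concatMap f xs)
    disjoint {v} (v∈fx , v∈rest) with ∈-concat⁻′ (map f xs) v∈rest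
    ... | ys , v∈ys , ys∈ with ∈-map⁻ f ys∈
    ...   | x′ , x′∈xs , refl = All.lookup x∉xs (subst (_∈ xs) (trans (sym (tag-f x′ v∈ys)) (tag-f x v∈fx)) x′∈xs) refl

coprime-*ʳ : ∀ {a b c} → Coprime a b → Coprime a c → Coprime a (b * c)
coprime-*ʳ {a} {b} {c} a⊥b a⊥c {d} (d∣a , d∣bc) = a⊥c (d∣a , coprime-divisor d⊥b d∣bc)
  where d⊥b : Coprime d b
        d⊥b (e∣d , e∣b) = a⊥b (∣-trans e∣d d∣a , e∣b)

coprime-^ˡ : ∀ {p X} k → Coprime p X → Coprime (p ^ k) X
coprime-^ˡ zero    _   = Coprime.1-coprimeTo _
coprime-^ˡ (suc k) p⊥X = Coprime.sym (coprime-*ʳ (Coprime.sym p⊥X) (Coprime.sym (coprime-^ˡ k p⊥X)))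

coprime∧∣∧∣⇒*∣ : ∀ {a b n} → Coprime a b → a ∣ n → b ∣ n → a * b ∣ n
coprime∧∣∧∣⇒*∣ {a} {b} a⊥b a∣n (divides c n≡cb) with coprime-divisor a⊥b (subst (a ∣_) (trans n≡cb (*-comm c b)) a∣n)
... | divides d c≡da = divides d (trans n≡cb (trans (cong (_* b) c≡da) (*-assoc d a b)))

^-monoʳ-∣ : ∀ p {a b} → a ≤ b → p ^ a ∣ p ^ b
^-monoʳ-∣ p {a} {b} a≤b = divides (p ^ (b ∸ a)) (begin
    p ^ b               ≡⟨ cong (p ^_) (sym (m+[n∸m]≡n a≤b)) ⟩
    p ^ (a + (b ∸ a))   ≡⟨ ^-distribˡ-+-* p a (b ∸ a) ⟩
    p ^ a * p ^ (b ∸ a) ≡⟨ *-comm (p ^ a) _ ⟩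
    p ^ (b ∸ a) * p ^ a ∎)
  where open ≡-Reasoning

∥-unique : ∀ {p a b n} → p ^ a ∥ n → p ^ b ∥ n → a ≡ b
∥-unique {p} {a} {b} (p^a∣n , p^1+a∤n) (p^b∣n , p^1+b∤n) with <-cmp a b
... | tri< a<b _ _ = ⊥-elim (p^1+a∤n (∣-trans (^-monoʳ-∣ p a<b) p^b∣n))
... | tri≈ _ a≡b _ = a≡b
... | tri> _ _ b<a = ⊥-elim (p^1+b∤n (∣-trans (^-monoʳ-∣ p b<a) p^a∣n))

n<m^n : ∀ {m} → 1 < m → ∀ n → n < m ^ n
n<m^n 1<m zero    = z<s
n<m^n {m} 1<m (suc n) = begin-strict
    suc n             <⟨ s≤s (n<m^n 1<m n) ⟩
    1 + m ^ n         ≤⟨ +-monoˡ-≤ (m ^ n) (≤-trans (s≤s z≤n) (n<m^n 1<m n)) ⟩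
    m ^ n + m ^ n     ≡⟨ cong (m ^ n +_) (sym (+-identityʳ (m ^ n))) ⟩
    2 * m ^ n         ≤⟨ *-monoˡ-≤ (m ^ n) 1<m ⟩
    m * m ^ n         ∎
  where open ≤-Reasoning

prime∣⇒∃∥ : ∀ {p} → Prime p → ∀ fuel m → m ≤ fuel → .{{_ : NonZero m}} → p ∣ m → Σ ℕ λ k → 1 ≤ k × p ^ k ∥ m
prime∣⇒∃∥ p-prime zero (suc m) () _
prime∣⇒∃∥ p-prime (suc fuel) m _ (divides zero m≡0) = ⊥-elim (≢-nonZero⁻¹ m m≡0)
prime∣⇒∃∥ {p} p-prime (suc fuel) m m≤1+fuel (divides (suc q′) m≡qp) with p ∣? suc q′
... | yes p∣q = suc k , s≤s z≤n , p^1+k∣m , p^2+k∤m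
  where
    instance
      p≢0 : NonZero p
      p≢0 = prime⇒nonZero p-prime
    q = suc q′
    m≡pq : m ≡ p * q
    m≡pq = trans m≡qp (*-comm q p)
    q<m : q < m
    q<m = subst (q <_) (sym m≡qp) (m<m*n q p (prime>1 p-prime))
    exact-q : Σ ℕ λ k → 1 ≤ k × p ^ k ∥ q
    exact-q = prime∣⇒∃∥ p-prime fuel q (s≤s⁻¹ (≤-trans q<m m≤1+fuel)) p∣q
    k : ℕ
    k = proj₁ exact-q
    p^k∥q : p ^ k ∥ q
    p^k∥q = proj₂ (proj₂ exact-q)
    p^1+k∣m : p ^ suc k ∣ m
    p^1+k∣m = subst (p ^ suc k ∣_) (sym m≡pq) (*-monoʳ-∣ p (proj₁ p^k∥q))
    p^2+k∤m : ¬ p ^ suc (suc k) ∣ m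
    p^2+k∤m p^2+k∣m = proj₂ p^k∥q (*-cancelˡ-∣ p (subst (p ^ suc (suc k) ∣_) m≡pq p^2+k∣m))
... | no p∤q = 1 , s≤s z≤n , p∣m , p²∤m
  where
    instance
      p≢0 : NonZero p
      p≢0 = prime⇒nonZero p-prime
    q = suc q′
    m≡pq : m ≡ p * q
    m≡pq = trans m≡qp (*-comm q p)
    p∣m : p ^ 1 ∣ m
    p∣m = divides q (trans m≡qp (cong (q *_) (sym (*-identityʳ p))))
    p²∤m : ¬ p ^ 2 ∣ m
    p²∤m p²∣m = p∤q (subst (_∣ q) (*-identityʳ p) (*-cancelˡ-∣ p (subst (p ^ 2 ∣_) m≡pq p²∣m)))

module ExactPrimePowers (n : ℕ) .{{_ : NonZero n}} where

  Exact : ℕ × ℕ → Set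
  Exact (p , k) = Prime p × 1 ≤ k × p ^ k ∥ n

  private
    exact? : ∀ p k → Dec (p ^ k ∥ n)
    exact? p k = (p ^ k ∣? n) ×-dec ¬? (p ^ suc k ∣? n)

    powersOf : ℕ → List (ℕ × ℕ)
    powersOf p = map (p ,_) (filter (exact? p) (range1 n))

  exactPrimePowers-exact : All Exact (exactPrimePowers n)
  exactPrimePowers-exact = All.tabulate exact
    where
      exact : ∀ {e} → e ∈ exactPrimePowers n → Exact e
      exact e∈ with ∈-concat⁻′ (map powersOf (filter prime? (range1 n))) e∈
      ... | ys , e∈ys , ys∈ with ∈-map⁻ powersOf ys∈
      ... | p , p∈ , refl with ∈-map⁻ (p ,_) e∈ys
      ... | k , k∈ , refl with ∈-filter⁻ (exact? p) {xs = range1 n} k∈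
      ... | k∈range , p^k∥n with ∈-applyUpTo⁻ suc k∈range
      ... | i , _ , refl = proj₂ (∈-filter⁻ prime? {xs = range1 n} p∈) , s≤s z≤n , p^k∥n

  ∈-exactPrimePowers⁺ : ∀ {p} → Prime p → p ∣ n → Σ ℕ λ k → (p , k) ∈ exactPrimePowers n
  ∈-exactPrimePowers⁺ {p} p-prime p∣n with prime∣⇒∃∥ p-prime n n ≤-refl p∣n
  ... | suc j , _ , p^k∥n = suc j , ∈-concat⁺′ (∈-map⁺ (p ,_) k∈) (∈-map⁺ powersOf p∈)
    where
      k∈ : suc j ∈ filter (exact? p) (range1 n)
      k∈ = ∈-filter⁺ (exact? p) (∈-range1 (s≤s z≤n) (<⇒≤ (<-≤-trans (n<m^n (prime>1 p-prime) (suc j)) (∣⇒≤ (proj₁ p^k∥n))))) p^k∥n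
      p∈ : p ∈ filter prime? (range1 n)
      p∈ = ∈-filter⁺ prime? (∈-range1 (<⇒≤ (prime>1 p-prime)) (∣⇒≤ p∣n)) p-prime

  exactPrimePowers-unique : Unique (exactPrimePowers n)
  exactPrimePowers-unique =
    concatMap-unique powersOf proj₁ tag (Unique.filter⁺ prime? (range1-unique n))
                     (λ p → Unique.map⁺ (cong proj₂) (Unique.filter⁺ (exact? p) (range1-unique n)))
    where
      tag : ∀ p {e} → e ∈ powersOf p → proj₁ e ≡ p
      tag p e∈ with ∈-map⁻ (p ,_) e∈
      ... | k , _ , refl = refl

module _ (t n : ℕ) .{{_ : NonZero n}} where
  open PrimePowerGluing t
  open ExactPrimePowers n

  module _ (s-coprime : ∀ {p k p′ k′} → Exact (p , k) → Exact (p′ , k′) → p ≢ p′ → Coprime (s p k) (s p′ k′)) where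

    private
      distinct-primes : ∀ {p k} L → Exact (p , k) → All ((p , k) ≢_) L → All Exact L → All (λ e → p ≢ proj₁ e) L
      distinct-primes []              _       _                 _                 = []
      distinct-primes ((p′ , k′) ∷ L) p^k∥n (pk≢p′k′ ∷ pk≢L) (p′^k′∥n ∷ L∥n) = p≢p′ ∷ distinct-primes L p^k∥n pk≢L L∥n
        where p≢p′ : _ ≢ p′
              p≢p′ refl = pk≢p′k′ (cong (p′ ,_) (∥-unique (proj₂ (proj₂ p^k∥n)) (proj₂ (proj₂ p′^k′∥n))))

      coprime-prodRep : ∀ {p k} L → Exact (p , k) → All (λ e → p ≢ proj₁ e) L → All Exact L → Coprime (s p k) (prodRep L)
      coprime-prodRep []              _     _             _              = Coprime.sym (Coprime.1-coprimeTo _)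
      coprime-prodRep ((p′ , k′) ∷ L) p^k∥n (p≢p′ ∷ p≢L) (p′^k′∥n ∷ L∥n) =
        coprime-*ʳ (s-coprime p^k∥n p′^k′∥n p≢p′) (coprime-prodRep L p^k∥n p≢L L∥n)

      unique⇒admissible : ∀ L → Unique L → All Exact L → Admissible L
      unique⇒admissible []            _           _              = tt
      unique⇒admissible ((p , k) ∷ L) (pk∉L ∷ L!) (p^k∥n ∷ L∥n) =
        proj₁ p^k∥n , proj₁ (proj₂ p^k∥n) , p≢L , coprime-prodRep L p^k∥n p≢L L∥n , unique⇒admissible L L! L∥n
        where p≢L = distinct-primes L p^k∥n pk∉L L∥n

    exactPrimePowers-admissible : Admissible (exactPrimePowers n)
    exactPrimePowers-admissible = unique⇒admissible (exactPrimePowers n) exactPrimePowers-unique exactPrimePowers-exact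

  private
    prodPow∣n : ∀ L → Admissible L → All Exact L → prodPow L ∣ n
    prodPow∣n []            _                             _              = 1∣ n
    prodPow∣n ((p , k) ∷ L) (p-prime , _ , p≢L , _ , adm) (p^k∥n ∷ L∥n) =
      coprime∧∣∧∣⇒*∣ (coprime-^ˡ k (prime∤⇒coprime p-prime (∤prodPow L p-prime p≢L adm)))
                     (proj₁ (proj₂ (proj₂ p^k∥n))) (prodPow∣n L adm L∥n)

    ∈⇒^∣prodPow : ∀ {p k} L → (p , k) ∈ L → p ^ k ∣ prodPow L
    ∈⇒^∣prodPow ((p , k) ∷ L) (here refl) = m∣m*n (prodPow L)
    ∈⇒^∣prodPow ((q , l) ∷ L) (there pk∈) = ∣n⇒∣m*n (q ^ l) (∈⇒^∣prodPow L pk∈)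

  -- A cofactor c ≥ 2 of prodPow L in n has a prime factor r, and r times the exact power of r in
  -- prodPow L would still divide n.
  prodPow-exactPrimePowers : Admissible (exactPrimePowers n) → prodPow (exactPrimePowers n) ≡ n
  prodPow-exactPrimePowers adm with prodPow∣n (exactPrimePowers n) adm exactPrimePowers-exact
  ... | divides c n≡c*prod = by-cofactor c n≡c*prod
    where
      L = exactPrimePowers n
      by-cofactor : ∀ c → n ≡ c * prodPow L → prodPow L ≡ n
      by-cofactor zero             n≡0      = ⊥-elim (≢-nonZero⁻¹ n n≡0)
      by-cofactor (suc zero)       n≡1*prod = sym (trans n≡1*prod (+-identityʳ (prodPow L)))
      by-cofactor c@(suc (suc _)) n≡c*prod with factorise c
      ... | record { factors = [] ; isFactorisation = () }
      ... | record { factors = r ∷ rs ; isFactorisation = c≡ ; factorsPrime = r-prime ∷ _ } =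
        ⊥-elim (proj₂ (proj₂ (proj₂ (All.lookup exactPrimePowers-exact r^k∈))) r^1+k∣n)
        where
          r∣c : r ∣ c
          r∣c = divides (product rs) (trans c≡ (*-comm r (product rs)))
          r∣n : r ∣ n
          r∣n = subst (r ∣_) (sym n≡c*prod) (∣m⇒∣m*n (prodPow L) r∣c)
          k : ℕ
          k = proj₁ (∈-exactPrimePowers⁺ r-prime r∣n)
          r^k∈ : (r , k) ∈ L
          r^k∈ = proj₂ (∈-exactPrimePowers⁺ r-prime r∣n)
          r^1+k∣n : r ^ suc k ∣ n
          r^1+k∣n = subst (r ^ suc k ∣_) (sym n≡c*prod) (*-pres-∣ r∣c (∈⇒^∣prodPow L r^k∈))

  module _ (adm : Admissible (exactPrimePowers n)) where
    private
      L = exactPrimePowers n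
      prodPow≡n : prodPow L ≡ n
      prodPow≡n = prodPow-exactPrimePowers adm

    S⊆Glued-exactPrimePowers : S n t ⊆ Glued L
    S⊆Glued-exactPrimePowers {x} = S⊆Glued L adm ∘ subst (λ m → S m t x) (sym prodPow≡n)

    Glued-exactPrimePowers⊆S : Glued L ⊆ S n t
    Glued-exactPrimePowers⊆S {x} x∈ =
      subst₂ (λ m y → S m t y) (trans (*-identityˡ (prodPow L)) prodPow≡n) (trans (cong (_* x) (σ-1 t)) (*-identityˡ x))
             (Glued⊆S L adm 1 (All.map prime∤1 (admissible⇒primes L adm)) x∈)

    σ≡prodRep-exactPrimePowers : σ t n ≡ prodRep L
    σ≡prodRep-exactPrimePowers = trans (cong (σ t) (sym prodPow≡n)) (σ-prodPow L adm)

-- The Frobenius number as a rational number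

toℚᵘ-ℤtoℚ : ∀ z → toℚᵘ (ℤtoℚ z) ℚᵘ.≃ mkℚᵘ z 0
toℚᵘ-ℤtoℚ z = ℚP.toℚᵘ-fromℚᵘ (mkℚᵘ z 0)

ℤtoℚ-+ : ∀ z w → ℤtoℚ (z ℤ.+ w) ≡ ℤtoℚ z ℚ.+ ℤtoℚ w
ℤtoℚ-+ z w = ℚP.toℚᵘ-injective (begin
    toℚᵘ (ℤtoℚ (z ℤ.+ w))                  ≈⟨ toℚᵘ-ℤtoℚ (z ℤ.+ w) ⟩
    mkℚᵘ (z ℤ.+ w) 0                        ≈⟨ *≡* (ring z w) ⟨
    mkℚᵘ z 0 ℚᵘ.+ mkℚᵘ w 0                  ≈⟨ ℚᵘP.+-cong (toℚᵘ-ℤtoℚ z) (toℚᵘ-ℤtoℚ w) ⟨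
    toℚᵘ (ℤtoℚ z) ℚᵘ.+ toℚᵘ (ℤtoℚ w)        ≈⟨ ℚP.toℚᵘ-homo-+ (ℤtoℚ z) (ℤtoℚ w) ⟨
    toℚᵘ (ℤtoℚ z ℚ.+ ℤtoℚ w)                ∎)
  where open ℚᵘP.≃-Reasoning
        ring : ∀ (a b : ℤ) → (a ℤ.* ℤ.+ 1 ℤ.+ b ℤ.* ℤ.+ 1) ℤ.* ℤ.+ 1 ≡ (a ℤ.+ b) ℤ.* ℤ.+ 1
        ring = ℤ-Solver.solve-∀

ℤtoℚ-* : ∀ z w → ℤtoℚ (z ℤ.* w) ≡ ℤtoℚ z ℚ.* ℤtoℚ w
ℤtoℚ-* z w = ℚP.toℚᵘ-injective (begin
    toℚᵘ (ℤtoℚ (z ℤ.* w))                  ≈⟨ toℚᵘ-ℤtoℚ (z ℤ.* w) ⟩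
    mkℚᵘ z 0 ℚᵘ.* mkℚᵘ w 0                  ≈⟨ ℚᵘP.*-cong (toℚᵘ-ℤtoℚ z) (toℚᵘ-ℤtoℚ w) ⟨
    toℚᵘ (ℤtoℚ z) ℚᵘ.* toℚᵘ (ℤtoℚ w)        ≈⟨ ℚP.toℚᵘ-homo-* (ℤtoℚ z) (ℤtoℚ w) ⟨
    toℚᵘ (ℤtoℚ z ℚ.* ℤtoℚ w)                ∎)
  where open ℚᵘP.≃-Reasoning

ℤtoℚ-neg : ∀ z → ℤtoℚ (ℤ.- z) ≡ ℚ.- ℤtoℚ z
ℤtoℚ-neg z = ℚP.toℚᵘ-injective (begin
    toℚᵘ (ℤtoℚ (ℤ.- z))                    ≈⟨ toℚᵘ-ℤtoℚ (ℤ.- z) ⟩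
    ℚᵘ.- mkℚᵘ z 0                           ≈⟨ ℚᵘP.-‿cong (toℚᵘ-ℤtoℚ z) ⟨
    ℚᵘ.- toℚᵘ (ℤtoℚ z)                      ≈⟨ ℚP.toℚᵘ-homo‿- (ℤtoℚ z) ⟨
    toℚᵘ (ℚ.- ℤtoℚ z)                       ∎)
  where open ℚᵘP.≃-Reasoning

ℕtoℚ : ℕ → ℚ
ℕtoℚ a = ℤtoℚ (ℤ.+ a)

ℕtoℚ-+ : ∀ a b → ℕtoℚ (a + b) ≡ ℕtoℚ a ℚ.+ ℕtoℚ b
ℕtoℚ-+ a b = trans (cong ℤtoℚ (ℤP.pos-+ a b)) (ℤtoℚ-+ (ℤ.+ a) (ℤ.+ b))

ℕtoℚ-* : ∀ a b → ℕtoℚ (a * b) ≡ ℕtoℚ a ℚ.* ℕtoℚ b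
ℕtoℚ-* a b = trans (cong ℤtoℚ (ℤP.pos-* a b)) (ℤtoℚ-* (ℤ.+ a) (ℤ.+ b))

ℤtoℚ-⊖ : ∀ m n → ℤtoℚ (m ⊖ n) ≡ ℚ.- ℕtoℚ n ℚ.+ ℕtoℚ m
ℤtoℚ-⊖ m n = begin
    ℤtoℚ (m ⊖ n)                     ≡⟨ cong ℤtoℚ (sym (ℤP.m-n≡m⊖n m n)) ⟩
    ℤtoℚ (ℤ.+ m ℤ.+ ℤ.- ℤ.+ n)       ≡⟨ ℤtoℚ-+ (ℤ.+ m) (ℤ.- ℤ.+ n) ⟩
    ℕtoℚ m ℚ.+ ℤtoℚ (ℤ.- ℤ.+ n)      ≡⟨ cong (ℕtoℚ m ℚ.+_) (ℤtoℚ-neg (ℤ.+ n)) ⟩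
    ℕtoℚ m ℚ.+ ℚ.- ℕtoℚ n            ≡⟨ ℚP.+-comm (ℕtoℚ m) _ ⟩
    ℚ.- ℕtoℚ n ℚ.+ ℕtoℚ m            ∎
  where open ≡-Reasoning

divℚ-*-ℕtoℚ : ∀ a b c w → 1 ≤ b → a * c ≡ w * b → divℚ a b ℚ.* ℕtoℚ c ≡ ℕtoℚ w
divℚ-*-ℕtoℚ a b@(suc b₀) c w _ ac≡wb = ℚP.toℚᵘ-injective (begin
    toℚᵘ (divℚ a b ℚ.* ℕtoℚ c)               ≈⟨ ℚP.toℚᵘ-homo-* (divℚ a b) (ℕtoℚ c) ⟩
    toℚᵘ (divℚ a b) ℚᵘ.* toℚᵘ (ℕtoℚ c)       ≈⟨ ℚᵘP.*-cong (ℚP.toℚᵘ-fromℚᵘ (mkℚᵘ (ℤ.+ a) b₀)) (toℚᵘ-ℤtoℚ (ℤ.+ c)) ⟩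
    mkℚᵘ (ℤ.+ a) b₀ ℚᵘ.* mkℚᵘ (ℤ.+ c) 0      ≈⟨ *≡* cross ⟩
    mkℚᵘ (ℤ.+ w) 0                           ≈⟨ toℚᵘ-ℤtoℚ (ℤ.+ w) ⟨
    toℚᵘ (ℕtoℚ w)                            ∎)
  where
    open ℚᵘP.≃-Reasoning
    cross : (ℤ.+ a ℤ.* ℤ.+ c) ℤ.* ℤ.+ 1 ≡ ℤ.+ w ℤ.* ℤ.+ suc (b₀ * 1)
    cross = trans (ℤP.*-identityʳ _) (trans (sym (ℤP.pos-* a c)) (trans (cong ℤ.+_ ac≡wb)
              (trans (cong (λ z → ℤ.+ (w * suc z)) (sym (*-identityʳ b₀))) (ℤP.pos-* w _))))

module FrobeniusValue (t : ℕ) (1≤t : 1 ≤ t) where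
  open PrimePowerGluing t

  Q≥1 : ∀ {p} → Prime p → 1 ≤ Q p
  Q≥1 {p} p-prime = ∸-monoˡ-≤ 1 (≤-trans (prime>1 p-prime) p≤p^t)
    where p≤p^t : p ≤ p ^ t
          p≤p^t = ≤-trans (≤-reflexive (sym (*-identityʳ p))) (^-monoʳ-≤ p {{prime⇒nonZero p-prime}} 1≤t)

  p^[t*[k+1]]≡ : ∀ {p} → Prime p → ∀ k → p ^ (t * (k + 1)) ≡ suc (Q p) ^ suc k
  p^[t*[k+1]]≡ {p} p-prime k = begin
      p ^ (t * (k + 1))       ≡⟨ sym (^-*-assoc p t (k + 1)) ⟩
      (p ^ t) ^ (k + 1)       ≡⟨ cong₂ _^_ (sym (suc-Q≡p^t p-prime)) (+-comm k 1) ⟩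
      suc (Q p) ^ suc k       ∎
    where open ≡-Reasoning

  p^[t*[k+1]]∸1≡Q*s : ∀ {p} → Prime p → ∀ k → p ^ (t * (k + 1)) ∸ 1 ≡ Q p * s p k
  p^[t*[k+1]]∸1≡Q*s {p} p-prime k = begin
      p ^ (t * (k + 1)) ∸ 1   ≡⟨ cong (_∸ 1) (trans (p^[t*[k+1]]≡ p-prime k) (sym (repunit-geometric (Q p) k))) ⟩
      Q p * s p k + 1 ∸ 1     ≡⟨ m+n∸n≡m _ 1 ⟩
      Q p * s p k             ∎
    where open ≡-Reasoning

  geomQuot≡s : ∀ {p} → Prime p → ∀ k → geomQuot t p k ≡ s p k
  geomQuot≡s {p} p-prime k =
    trans (cong (λ z → divℕ z (p ^ t ∸ 1)) (p^[t*[k+1]]∸1≡Q*s p-prime k)) (divℕ-*ˡ (Q p) (Q≥1 p-prime))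
    where divℕ-*ˡ : ∀ d → 1 ≤ d → divℕ (d * s p k) d ≡ s p k
          divℕ-*ˡ (suc d₀) _ = trans (cong (_/ suc d₀) (*-comm (suc d₀) (s p k))) (m*n/n≡m (s p k) (suc d₀))

  -- With E = (p ^ t) ^ (k + 1), term t p k = (E² - p ^ t) / (E - 1), whose numerator and
  -- denominator are Q p times W p k and s p k respectively.
  term*s≡W : ∀ {p} → Prime p → ∀ k′ → term t p (suc k′) ℚ.* ℕtoℚ (s p (suc k′)) ≡ ℕtoℚ (W p (suc k′))
  term*s≡W {p} p-prime k′ = divℚ-*-ℕtoℚ _ _ (s p k) (W p k) 1≤denominator numerator*s≡W*denominator
    where
      open RepunitSemigroup (Q p) k′ using (P; k; E; E*E≡W*Q+P)
      numerator≡W*Q : p ^ (2 * t * (k + 1)) ∸ p ^ t ≡ W p k * Q p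
      numerator≡W*Q = begin
        p ^ (2 * t * (k + 1)) ∸ p ^ t                ≡⟨ cong₂ _∸_ (trans (cong (p ^_) (double t k)) (^-distribˡ-+-* p (t * (k + 1)) (t * (k + 1))))
                                                                   (sym (suc-Q≡p^t p-prime)) ⟩
        p ^ (t * (k + 1)) * p ^ (t * (k + 1)) ∸ P    ≡⟨ cong (λ z → z * z ∸ P) (p^[t*[k+1]]≡ p-prime k) ⟩
        E * E ∸ P                                    ≡⟨ cong (_∸ P) E*E≡W*Q+P ⟩
        W p k * Q p + P ∸ P                          ≡⟨ m+n∸n≡m (W p k * Q p) P ⟩
        W p k * Q p                                  ∎
        where open ≡-Reasoning
              double : ∀ t k → 2 * t * (k + 1) ≡ t * (k + 1) + t * (k + 1)
              double = solve-∀
      1≤denominator : 1 ≤ p ^ (t * (k + 1)) ∸ 1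
      1≤denominator = ≤-trans (*-mono-≤ (Q≥1 p-prime) (repunit>0 P k)) (≤-reflexive (sym (p^[t*[k+1]]∸1≡Q*s p-prime k)))
      numerator*s≡W*denominator : (p ^ (2 * t * (k + 1)) ∸ p ^ t) * s p k ≡ W p k * (p ^ (t * (k + 1)) ∸ 1)
      numerator*s≡W*denominator = begin
        (p ^ (2 * t * (k + 1)) ∸ p ^ t) * s p k      ≡⟨ cong (_* s p k) numerator≡W*Q ⟩
        W p k * Q p * s p k                          ≡⟨ *-assoc (W p k) (Q p) (s p k) ⟩
        W p k * (Q p * s p k)                        ≡⟨ cong (W p k *_) (sym (p^[t*[k+1]]∸1≡Q*s p-prime k)) ⟩
        W p k * (p ^ (t * (k + 1)) ∸ 1)              ∎
        where open ≡-Reasoning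

  termSum : List (ℕ × ℕ) → ℚ
  termSum = foldr (λ pk acc → term t (proj₁ pk) (proj₂ pk) ℚ.+ acc) 0ℚ

  prodRep*termSum≡gluedW : ∀ L → Admissible L → ℕtoℚ (prodRep L) ℚ.* termSum L ≡ ℕtoℚ (gluedW L)
  prodRep*termSum≡gluedW []                  _                      = ℚP.*-zeroʳ (ℕtoℚ 1)
  prodRep*termSum≡gluedW ((p , suc k′) ∷ L) (p-prime , _ , _ , _ , adm) = begin
      ℕtoℚ (s′ * N) ℚ.* (τ ℚ.+ termSum L)                           ≡⟨ cong (ℚ._* (τ ℚ.+ termSum L)) (ℕtoℚ-* s′ N) ⟩
      ℕtoℚ s′ ℚ.* ℕtoℚ N ℚ.* (τ ℚ.+ termSum L)                      ≡⟨ distrib (ℕtoℚ N) (ℕtoℚ s′) τ (termSum L) ⟩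
      ℕtoℚ N ℚ.* (τ ℚ.* ℕtoℚ s′) ℚ.+ ℕtoℚ s′ ℚ.* (ℕtoℚ N ℚ.* termSum L)
                                                                    ≡⟨ cong₂ (λ a b → ℕtoℚ N ℚ.* a ℚ.+ ℕtoℚ s′ ℚ.* b)
                                                                             (term*s≡W p-prime k′) (prodRep*termSum≡gluedW L adm) ⟩
      ℕtoℚ N ℚ.* ℕtoℚ (W p (suc k′)) ℚ.+ ℕtoℚ s′ ℚ.* ℕtoℚ (gluedW L) ≡⟨ sym (cong₂ ℚ._+_ (ℕtoℚ-* N _) (ℕtoℚ-* s′ (gluedW L))) ⟩
      ℕtoℚ (N * W p (suc k′)) ℚ.+ ℕtoℚ (s′ * gluedW L)              ≡⟨ sym (ℕtoℚ-+ (N * W p (suc k′)) (s′ * gluedW L)) ⟩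
      ℕtoℚ (N * W p (suc k′) + s′ * gluedW L)                       ∎
    where
      open ≡-Reasoning
      s′ = s p (suc k′)
      N = prodRep L
      τ = term t p (suc k′)
      distrib : ∀ (N s τ X : ℚ) → s ℚ.* N ℚ.* (τ ℚ.+ X) ≡ N ℚ.* (τ ℚ.* s) ℚ.+ s ℚ.* (N ℚ.* X)
      distrib = +-*-Solver.solve 4 (λ N s τ X → (s :* N) :* (τ :+ X) := N :* (τ :* s) :+ s :* (N :* X)) refl
        where open +-*-Solver

  frobenius-value : ∀ n → Admissible (exactPrimePowers n) → σ t n ≡ prodRep (exactPrimePowers n) →
                    ℤtoℚ (gluedW (exactPrimePowers n) ⊖ prodRep (exactPrimePowers n)) ≡ frobeniusFormula n t
  frobenius-value n adm σn≡N = begin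
      ℤtoℚ (gluedW L ⊖ N)                        ≡⟨ ℤtoℚ-⊖ (gluedW L) N ⟩
      ℚ.- ℕtoℚ N ℚ.+ ℕtoℚ (gluedW L)             ≡⟨ cong (ℚ.- ℕtoℚ N ℚ.+_) (sym (prodRep*termSum≡gluedW L adm)) ⟩
      ℚ.- ℕtoℚ N ℚ.+ ℕtoℚ N ℚ.* termSum L        ≡⟨ sym (distrib (ℕtoℚ N) (termSum L)) ⟩
      ℕtoℚ N ℚ.* (ℚ.- 1ℚ ℚ.+ termSum L)          ≡⟨ cong (λ z → ℕtoℚ z ℚ.* (ℚ.- 1ℚ ℚ.+ termSum L)) (sym σn≡N) ⟩
      frobeniusFormula n t                       ∎
    where
      open ≡-Reasoning
      L = exactPrimePowers n
      N = prodRep L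
      distrib : ∀ (N X : ℚ) → N ℚ.* (ℚ.- 1ℚ ℚ.+ X) ≡ ℚ.- N ℚ.+ N ℚ.* X
      distrib = +-*-Solver.solve 2 (λ N X → N :* (:- con 1ℚ :+ X) := :- N :+ N :* X) refl
        where open +-*-Solver

CoprimeHyp⇒s-coprime : ∀ {n t} .{{_ : NonZero n}} → 1 ≤ t → CoprimeHyp n t →
  let open PrimePowerGluing t; open ExactPrimePowers n in
  ∀ {p k p′ k′} → Exact (p , k) → Exact (p′ , k′) → p ≢ p′ → Coprime (s p k) (s p′ k′)
CoprimeHyp⇒s-coprime {n} {t} 1≤t hyp {p} {k} {p′} {k′} (p-prime , 1≤k , p^k∥n) (p′-prime , 1≤k′ , p′^k′∥n) p≢p′ =
  gcd≡1⇒coprime (subst₂ (λ a b → gcd a b ≡ 1) (geomQuot≡s p-prime k) (geomQuot≡s p′-prime k′)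
                  (hyp p k p′ k′ p-prime p′-prime 1≤k 1≤k′ p^k∥n p′^k′∥n p^k≢p′^k′))
  where
    open FrobeniusValue t 1≤t
    p^k≢p′^k′ : p ^ k ≢ p′ ^ k′
    p^k≢p′^k′ p^k≡p′^k′ = p≢p′ (prime∣prime⇒≡ p-prime p′-prime (prime∣^⇒∣ k′ p-prime
                            (subst (p ∣_) p^k≡p′^k′ (subst (_∣ p ^ k) (*-identityʳ p) (^-monoʳ-∣ p 1≤k)))))

theorem1p4 : (n t : ℕ) → 1 ≤ n → 1 ≤ t → CoprimeHyp n t →
    IsNumericalSemigroup (S n t) ×
    Σ ℤ (λ f → IsFrobeniusNumber (S n t) f × ℤtoℚ f ≡ frobeniusFormula n t)
theorem1p4 n t 1≤n 1≤t hyp =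
  numerical-⊆ Glued⊆S (AperyMax⇒numerical apery) ,
  gluedW L ⊖ prodRep L ,
  frobenius-⊆⊇ Glued⊆S S⊆Glued (AperyMax⇒frobenius apery) ,
  frobenius-value n adm (σ≡prodRep-exactPrimePowers t n adm)
  where
    instance
      n≢0 : NonZero n
      n≢0 = >-nonZero 1≤n
    open PrimePowerGluing t using (gluedW; prodRep; Glued; Admissible; Glued-AperyMax)
    open FrobeniusValue t 1≤t using (frobenius-value)
    L = exactPrimePowers n
    adm : Admissible L
    adm = exactPrimePowers-admissible t n (CoprimeHyp⇒s-coprime 1≤t hyp)
    apery : AperyMax (Glued L) (prodRep L) (gluedW L)
    apery = Glued-AperyMax L adm
    S⊆Glued : S n t ⊆ Glued L
    S⊆Glued = S⊆Glued-exactPrimePowers t n adm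
    Glued⊆S : Glued L ⊆ S n t
    Glued⊆S = Glued-exactPrimePowers⊆S t n adm
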